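{- For all integers $m\ge 5$ and $k\ge -1$, $M(m,2m+2k-1)\le 3m+k-3$.
   Context: Let $a_1<\cdots<a_m$ and $b_1<\cdots<b_n$ be two sorted lists whose $m+n$ elements are distinct and whose interleaving is unknown. A deterministic merging algorithm learns information only through pairwise comparisons between elements and must determine the full linear order of all $m+n$ elements. $M(m,n)$ is the minimum over all such algorithms of the worst-case number of comparisons used. -}

module Defs where

open import Data.Nat using (ℕ; _<_; _≤_; _<ᵇ_)
open import Data.Fin using (Fin) renaming (_<_ to _<ᶠ_)
open import Data.Sum using (_⊎_; inj₁; inj₂)
open import Data.Bool using (Bool; true; false)
open import Data.List using (List; []; _∷_; length)
open import Data.Product using (Σ; _×_)
open import Function.Definitions using (Injective)
open import Function.Bundles using (_⇔_)
open import Relation.Binary.PropositionalEquality using (_≡_)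

-- The m+n elements: a_i = inj₁ i, b_j = inj₂ j.
Elem : ℕ → ℕ → Set
Elem m n = Fin m ⊎ Fin n

-- An input: distinct values (in ℕ; only their relative order matters)
-- for the elements, with both lists sorted increasingly.
record Input (m n : ℕ) : Set where
  field
    val      : Elem m n → ℕ
    distinct : Injective _≡_ _≡_ val
    a-sorted : ∀ (i i' : Fin m) → i <ᶠ i' → val (inj₁ i) < val (inj₁ i')
    b-sorted : ∀ (j j' : Fin n) → j <ᶠ j' → val (inj₂ j) < val (inj₂ j')
open Input public

SameOrder : ∀ {m n} → Input m n → Input m n → Set
SameOrder I J = ∀ x y → (val I x < val I y) ⇔ (val J x < val J y)

-- Deterministic comparison-based algorithm = binary decision tree:
-- at a node, compare elements x and y; go left if x < y, right otherwise.
data Tree (m n : ℕ) : Set where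
  leaf : Tree m n
  node : Elem m n → Elem m n → Tree m n → Tree m n → Tree m n

-- Sequence of comparison outcomes the algorithm observes on input I
-- (its length is the number of comparisons used).
run : ∀ {m n} → Tree m n → Input m n → List Bool
run leaf I = []
run (node x y l r) I with val I x <ᵇ val I y
... | true  = true  ∷ run l I
... | false = false ∷ run r I

Sorts : ∀ {m n} → Tree m n → Set
Sorts {m} {n} T = ∀ (I J : Input m n) → run T I ≡ run T J → SameOrder I J

M≤ : ℕ → ℕ → ℕ → Set
M≤ m n c = Σ (Tree m n) λ T → Sorts T × (∀ (I : Input m n) → length (run T I) ≤ c)

module Submission where

-- A merge outcome is encoded by its rank vector: r i is the number of b's below a_i, a
-- monotone sequence with values in [0, n], and the comparison of a_i with b_j is the
-- question r i ≤ j. Decision trees over such questions compile to merging algorithms,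
-- so it suffices to bound their depth. The main recursion compares the largest a with
-- the second largest b and, if it is larger, with the largest b; this gives
--   M(m+1, n+2) ≤ 1 + max (M(m+1, n), 1 + M(m, n+2)),
-- which propagates the bound 3m + k - 3 from (m, n) and (m - 1, n + 2) to (m, n + 2).
-- The induction starts from linear merging, M(m, n) ≤ m + n - 1, at n = 2m - 3 and from
-- m = 5, where similar one- and two-comparison reductions bring everything down to a
-- few small (partly constrained) problems, solved by explicit decision trees that are
-- checked by evaluation.

open import Defs

module Merging where

  open import Data.Bool using (Bool; true; false; if_then_else_; _∧_; T)
  open import Data.Bool.Properties using (T-∧; T-≡)
  open import Data.Empty using (⊥-elim)
  open import Data.Fin using (Fin; toℕ; fromℕ<)
  open import Data.Fin.Properties using (toℕ-fromℕ<; toℕ-injective; toℕ<n)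
  open import Data.List using (List; []; _∷_; length)
  open import Data.Nat
    using (ℕ; zero; suc; _+_; _*_; _∸_; _≤_; _<_; z≤n; s≤s; _⊔_; _⊓_; _≤ᵇ_; _<ᵇ_; _≡ᵇ_; _<?_)
  open import Data.Nat.Properties
  open import Data.Nat.Tactic.RingSolver using (solve-∀)
  open import Data.Product using (Σ-syntax; _×_; _,_; proj₁; proj₂)
  open import Data.Sum using (inj₁; inj₂)
  open import Data.Unit using (tt)
  open import Function using (_∘_; id)
  open import Function.Bundles using (_⇔_; mk⇔; Equivalence)
  import Function.Properties.Equivalence as ⇔
  open import Relation.Binary.PropositionalEquality
  open import Relation.Nullary using (yes; no)
  open import Relation.Nullary.Reflects using (Reflects; ofʸ; ofⁿ)

  reflects-≡ : ∀ {A B : Set} {b c} → Reflects A b → Reflects B c → (A → B) → (B → A) → b ≡ c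
  reflects-≡ (ofʸ _)  (ofʸ _)  _     _     = refl
  reflects-≡ (ofʸ a)  (ofⁿ ¬b) A⇒B   _     = ⊥-elim (¬b (A⇒B a))
  reflects-≡ (ofⁿ ¬a) (ofʸ b)  _     B⇒A   = ⊥-elim (¬a (B⇒A b))
  reflects-≡ (ofⁿ _)  (ofⁿ _)  _     _     = refl

  ≤ᵇ-+-∸ : ∀ c x j → (x ≤ᵇ c + j) ≡ (x ∸ c ≤ᵇ j)
  ≤ᵇ-+-∸ c x j = reflects-≡ (≤ᵇ-reflects-≤ x (c + j)) (≤ᵇ-reflects-≤ (x ∸ c) j)
    (m≤n+o⇒m∸n≤o x c) (λ x∸c≤j → ≤-trans (m≤n+m∸n x c) (+-monoʳ-≤ c x∸c≤j))

  Rank : Set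
  Rank = ℕ → ℕ

  data Strategy : Set where
    answer : Rank → Strategy
    ask    : ℕ → ℕ → Strategy → Strategy → Strategy

  decide : Strategy → Rank → Rank
  decide (answer f)    r = f
  decide (ask i j s t) r = if r i ≤ᵇ j then decide s r else decide t r

  depth : Strategy → ℕ
  depth (answer _)    = 0
  depth (ask _ _ s t) = suc (depth s ⊔ depth t)

  Recovers : ℕ → (Rank → Set) → ℕ → Set
  Recovers m P d =
    Σ[ s ∈ Strategy ] depth s ≤ d × (∀ r → P r → ∀ i → i < m → decide s r i ≡ r i)

  Monotone : ℕ → Rank → Set
  Monotone m r = ∀ {i i'} → i ≤ i' → i' < m → r i ≤ r i'

  Interleaving : ℕ → ℕ → Rank → Set
  Interleaving m n r = Monotone m r × (∀ i → i < m → r i ≤ n)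

  -- a_m is already known to lie above b_{n-1}, i.e. in one of the last two gaps.
  LastNearTop : ℕ → ℕ → Rank → Set
  LastNearTop m n r = Interleaving (suc m) (suc n) r × n ≤ r m

  interleaving-init : ∀ {m n r} → Interleaving (suc m) n r → Interleaving m n r
  interleaving-init (mono , bounded) =
    (λ i≤i' i'<m → mono i≤i' (m<n⇒m<1+n i'<m)) , (λ i i<m → bounded i (m<n⇒m<1+n i<m))

  interleaving-tail : ∀ {m n r} → Interleaving (suc m) n r → Interleaving m n (r ∘ suc)
  interleaving-tail (mono , bounded) =
    (λ i≤i' i'<m → mono (s≤s i≤i') (s≤s i'<m)) , (λ i i<m → bounded (suc i) (s≤s i<m))

  interleaving-capped : ∀ {m n j r} → Interleaving (suc m) n r → r m ≤ j → Interleaving (suc m) j r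
  interleaving-capped (mono , _) rm≤j = mono , λ i i≤m → ≤-trans (mono (≤-pred i≤m) ≤-refl) rm≤j

  near-top-tail : ∀ {m n r} → LastNearTop (suc m) n r → LastNearTop m n (r ∘ suc)
  near-top-tail (I , n≤r) = interleaving-tail I , n≤r

  weaken : ∀ {m d d'} {P Q : Rank → Set} →
           (∀ {r} → Q r → P r) → d ≤ d' → Recovers m P d → Recovers m Q d'
  weaken Q⇒P d≤d' (s , ds , cs) = s , ≤-trans ds d≤d' , λ r q → cs r (Q⇒P q)

  recovers-nothing : ∀ {P : Rank → Set} → Recovers 0 P 0
  recovers-nothing = answer (λ _ → 0) , z≤n , λ _ _ _ ()

  branch : ∀ {m d} {P P≤ P> : Rank → Set} i j →
           Recovers m P≤ d → Recovers m P> d →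
           (∀ {r} → P r → r i ≤ j → P≤ r) → (∀ {r} → P r → j < r i → P> r) →
           Recovers m P (suc d)
  branch {m} {P = P} i j (s , ds , cs) (t , dt , ct) to≤ to> =
    ask i j s t , s≤s (⊔-lub ds dt) , correct
    where
    correct : ∀ r → P r → ∀ k → k < m → decide (ask i j s t) r k ≡ r k
    correct r p with r i ≤ᵇ j | ≤ᵇ-reflects-≤ (r i) j
    ... | true  | ofʸ ri≤j = cs r (to≤ p ri≤j)
    ... | false | ofⁿ ri≰j = ct r (to> p (≰⇒> ri≰j))

  relabel : (ℕ → ℕ) → (ℕ → ℕ) → (Rank → Rank) → Strategy → Strategy
  relabel φ ψ g (answer f)    = answer (g f)
  relabel φ ψ g (ask i j s t) = ask (φ i) (ψ j) (relabel φ ψ g s) (relabel φ ψ g t)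

  depth-relabel : ∀ φ ψ g s → depth (relabel φ ψ g s) ≡ depth s
  depth-relabel φ ψ g (answer _)    = refl
  depth-relabel φ ψ g (ask _ _ s t) =
    cong₂ (λ x y → suc (x ⊔ y)) (depth-relabel φ ψ g s) (depth-relabel φ ψ g t)

  decide-relabel : ∀ φ ψ g s {r r'} → (∀ i j → (r (φ i) ≤ᵇ ψ j) ≡ (r' i ≤ᵇ j)) →
                   decide (relabel φ ψ g s) r ≡ g (decide s r')
  decide-relabel φ ψ g (answer f)    same = refl
  decide-relabel φ ψ g (ask i j s t) {r' = r'} same rewrite same i j with r' i ≤ᵇ j
  ... | true  = decide-relabel φ ψ g s same
  ... | false = decide-relabel φ ψ g t same

  -- To recover r, run a strategy for  view r , translating its questions by φ and ψ
  -- and its answer by g.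
  reduce : ∀ {m m' d} {P Q : Rank → Set} (φ ψ : ℕ → ℕ) (view g : Rank → Rank) →
           (∀ r i j → (r (φ i) ≤ᵇ ψ j) ≡ (view r i ≤ᵇ j)) →
           (∀ {r} → Q r → P (view r)) →
           (∀ {r} → Q r → ∀ ρ → (∀ i → i < m' → ρ i ≡ view r i) → ∀ k → k < m → g ρ k ≡ r k) →
           Recovers m' P d → Recovers m Q d
  reduce φ ψ view g same Q⇒P rebuild (s , ds , cs) =
    relabel φ ψ g s ,
    subst (_≤ _) (sym (depth-relabel φ ψ g s)) ds ,
    λ r q k k<m → trans (cong (λ f → f k) (decide-relabel φ ψ g s (same r)))
                        (rebuild q (decide s (view r)) (cs (view r) (Q⇒P q)) k k<m)

  known-last : ∀ {m d} {P Q : Rank → Set} s → Recovers m P d →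
               (∀ {r} → Q r → P r × r m ≡ s) → Recovers (suc m) Q d
  known-last {m} {Q = Q} s R known =
    reduce id id id (λ ρ k → if m ≤ᵇ k then s else ρ k) (λ _ _ _ → refl) (λ q → proj₁ (known q)) rebuild R
    where
    rebuild : ∀ {r} → Q r → ∀ ρ → (∀ i → i < m → ρ i ≡ r i) →
              ∀ k → k < suc m → (if m ≤ᵇ k then s else ρ k) ≡ r k
    rebuild {r} q ρ agree k k≤m with m ≤ᵇ k | ≤ᵇ-reflects-≤ m k
    ... | true  | ofʸ m≤k = trans (sym (proj₂ (known q))) (cong r (≤-antisym m≤k (≤-pred k≤m)))
    ... | false | ofⁿ m≰k = agree k (≰⇒> m≰k)

  known-first : ∀ {m d} {P Q : Rank → Set} s → Recovers m P d →
                (∀ {r} → Q r → P (r ∘ suc) × r 0 ≡ s) → Recovers (suc m) Q d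
  known-first {m} {Q = Q} s R known =
    reduce suc id (_∘ suc) prepend (λ _ _ _ → refl) (λ q → proj₁ (known q)) rebuild R
    where
    prepend : Rank → Rank
    prepend ρ zero    = s
    prepend ρ (suc k) = ρ k
    rebuild : ∀ {r} → Q r → ∀ ρ → (∀ i → i < m → ρ i ≡ r (suc i)) →
              ∀ k → k < suc m → prepend ρ k ≡ r k
    rebuild q ρ agree zero    _     = sym (proj₂ (known q))
    rebuild q ρ agree (suc k) k<m+1 = agree k (≤-pred k<m+1)

  lower-by : ∀ {m d} {P Q : Rank → Set} c → Recovers m P d →
             (∀ {r} → Q r → P (λ i → r i ∸ c) × (∀ i → i < m → c ≤ r i)) → Recovers m Q d
  lower-by {m} {Q = Q} c R above =
    reduce id (c +_) (λ r i → r i ∸ c) (λ ρ k → c + ρ k) (λ r i j → ≤ᵇ-+-∸ c (r i) j)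
      (λ q → proj₁ (above q)) rebuild R
    where
    rebuild : ∀ {r} → Q r → ∀ ρ → (∀ i → i < m → ρ i ≡ r i ∸ c) → ∀ k → k < m → c + ρ k ≡ r k
    rebuild q ρ agree k k<m = trans (cong (c +_) (agree k k<m)) (m+[n∸m]≡n (proj₂ (above q) k k<m))

  Box : ℕ → Rank → Rank → Rank → Set
  Box m lo hi r = Monotone m r × (∀ k → k < m → lo k ≤ r k × r k ≤ hi k)

  cap : ℕ → ℕ → Rank → Rank
  cap i j hi k = if k ≤ᵇ i then hi k ⊓ j else hi k

  raise : ℕ → ℕ → Rank → Rank
  raise i j lo k = if i ≤ᵇ k then lo k ⊔ suc j else lo k

  box-cap : ∀ {m lo hi r i j} → Box m lo hi r → i < m → r i ≤ j → Box m lo (cap i j hi) r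
  box-cap {m} {lo} {hi} {r} {i} {j} (mono , bounds) i<m ri≤j = mono , λ k k<m → proj₁ (bounds k k<m) , upper k k<m
    where
    upper : ∀ k → k < m → r k ≤ cap i j hi k
    upper k k<m with k ≤ᵇ i | ≤ᵇ-reflects-≤ k i
    ... | true  | ofʸ k≤i = ⊓-glb (proj₂ (bounds k k<m)) (≤-trans (mono k≤i i<m) ri≤j)
    ... | false | _       = proj₂ (bounds k k<m)

  box-raise : ∀ {m lo hi r i j} → Box m lo hi r → j < r i → Box m (raise i j lo) hi r
  box-raise {m} {lo} {hi} {r} {i} {j} (mono , bounds) j<ri = mono , λ k k<m → lower k k<m , proj₂ (bounds k k<m)
    where
    lower : ∀ k → k < m → raise i j lo k ≤ r k
    lower k k<m with i ≤ᵇ k | ≤ᵇ-reflects-≤ i k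
    ... | true  | ofʸ i≤k = ⊔-lub (proj₁ (bounds k k<m)) (≤-trans j<ri (mono i≤k k<m))
    ... | false | _       = proj₁ (bounds k k<m)

  -- A comparison tree without answers at its leaves: along each branch the box lo ≤ r ≤ hi
  -- is tightened by the outcome, and a leaf is valid once the box has collapsed to lo.
  data Certificate : Set where
    done : Certificate
    cmp  : ℕ → ℕ → Certificate → Certificate → Certificate

  strategy : Certificate → Rank → Strategy
  strategy done           lo = answer lo
  strategy (cmp i j c c') lo = ask i j (strategy c lo) (strategy c' (raise i j lo))

  agree : ℕ → Rank → Rank → Bool
  agree zero    lo hi = true
  agree (suc m) lo hi = (lo m ≡ᵇ hi m) ∧ agree m lo hi

  valid : ℕ → Certificate → Rank → Rank → Bool
  valid m done           lo hi = agree m lo hi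
  valid m (cmp i j c c') lo hi = (i <ᵇ m) ∧ (valid m c lo (cap i j hi) ∧ valid m c' (raise i j lo) hi)

  agree-sound : ∀ m {lo hi} → T (agree m lo hi) → ∀ k → k < m → lo k ≡ hi k
  agree-sound (suc m) {lo} {hi} ok k k≤m with Equivalence.to T-∧ ok | m≤n⇒m<n∨m≡n (≤-pred k≤m)
  ... | _  , rest | inj₁ k<m  = agree-sound m rest k k<m
  ... | eq , _    | inj₂ refl = ≡ᵇ⇒≡ (lo k) (hi k) eq

  certified : ∀ m c lo hi → T (valid m c lo hi) → Recovers m (Box m lo hi) (depth (strategy c lo))
  certified m done lo hi ok = answer lo , ≤-refl , λ r (_ , bounds) k k<m →
    ≤-antisym (proj₁ (bounds k k<m)) (subst (r k ≤_) (sym (agree-sound m ok k k<m)) (proj₂ (bounds k k<m)))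
  certified m (cmp i j c c') lo hi ok
    with Equivalence.to T-∧ ok
  ... | i<m , rest with Equivalence.to T-∧ rest
  ... | ok-c , ok-c' = branch i j
          (weaken id (m≤m⊔n _ _) (certified m c lo (cap i j hi) ok-c))
          (weaken id (m≤n⊔m _ _) (certified m c' (raise i j lo) hi ok-c'))
          (λ box ri≤j → box-cap box (<ᵇ⇒< i m i<m) ri≤j)
          box-raise

  interleaving-box : ∀ {m n r} → Interleaving m n r → Box m (λ _ → 0) (λ _ → n) r
  interleaving-box (mono , bounded) = mono , λ k k<m → z≤n , bounded k k<m

  step-at : ℕ → ℕ → Rank
  step-at m n k = if m ≤ᵇ k then n else 0

  near-top-box : ∀ {m n r} → LastNearTop m n r → Box (suc m) (step-at m n) (λ _ → suc n) r
  near-top-box {m} {n} {r} ((mono , bounded) , n≤rm) = mono , λ k k≤m → lower k k≤m , bounded k k≤m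
    where
    lower : ∀ k → k < suc m → step-at m n k ≤ r k
    lower k k≤m with m ≤ᵇ k | ≤ᵇ-reflects-≤ m k
    ... | true  | ofʸ m≤k = subst (λ x → n ≤ r x) (≤-antisym m≤k (≤-pred k≤m)) n≤rm
    ... | false | _       = z≤n

  first-capped : ℕ → Rank
  first-capped n zero    = 1
  first-capped n (suc _) = suc n

  near-top-first-box : ∀ {m n r} → LastNearTop m n r × r 0 ≤ 1 →
                       Box (suc m) (step-at m n) (first-capped n) r
  near-top-first-box (L , r0≤1) with near-top-box L
  ... | mono , bounds = mono , λ where
    zero    0≤m → proj₁ (bounds 0 0≤m) , r0≤1
    (suc k) k<m → bounds (suc k) k<m

  known-last-interleaving : ∀ {m n d} s → Recovers m (Interleaving m n) d →
                            Recovers (suc m) (λ r → Interleaving (suc m) n r × r m ≡ s) d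
  known-last-interleaving s R = known-last s R λ (I , rm≡s) → interleaving-init I , rm≡s

  linear-merge : ∀ m n → Recovers (suc m) (Interleaving (suc m) n) (m + n)
  all-but-last : ∀ m n → Recovers m (Interleaving m (suc n)) (m + n)

  linear-merge m zero = answer (λ _ → 0) , z≤n , λ r (_ , bounded) i i≤m → sym (n≤0⇒n≡0 (bounded i i≤m))
  linear-merge m (suc n) = weaken id (≤-reflexive (sym (+-suc m n)))
    (branch m n (linear-merge m n) (known-last-interleaving (suc n) (all-but-last m n))
      interleaving-capped
      (λ I n<rm → I , ≤-antisym (proj₂ I m ≤-refl) n<rm))

  all-but-last zero    n = weaken id z≤n recovers-nothing
  all-but-last (suc m) n = weaken id (≤-reflexive (+-suc m n)) (linear-merge m (suc n))

  settle-last : ∀ {m n d} → Recovers m (Interleaving m (suc n)) d → Recovers (suc m) (LastNearTop m n) (suc d)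
  settle-last {m} R = branch m _ (known-last-interleaving _ R) (known-last-interleaving _ R)
    (λ (I , n≤rm) rm≤n → I , ≤-antisym rm≤n n≤rm)
    (λ (I , _) n<rm → I , ≤-antisym (proj₂ I m ≤-refl) n<rm)

  split-last : ∀ {m n d} → Recovers (suc m) (Interleaving (suc m) n) d →
               Recovers (suc m) (LastNearTop m (suc n)) d →
               Recovers (suc m) (Interleaving (suc m) (2 + n)) (suc d)
  split-last {m} {n} below above = branch m n below above interleaving-capped (λ I n<rm → I , n<rm)

  settle-first : ∀ {m d} {P Q : Rank → Set} → Recovers m P d →
                 (∀ {r} → Q r → P (r ∘ suc) × r 0 ≤ 1) → Recovers (suc m) Q (suc d)
  settle-first {Q = Q} R split = branch {P≤ = λ r → Q r × r 0 ≤ 0} {P> = λ r → Q r × 0 < r 0} 0 0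
    (known-first 0 R λ (q , r0≤0) → proj₁ (split q) , n≤0⇒n≡0 r0≤0)
    (known-first 1 R λ (q , 0<r0) → proj₁ (split q) , ≤-antisym (proj₂ (split q)) 0<r0)
    _,_ _,_

  -- Compare a_0 with b_1. If a_0 is larger, then b_0 and b_1 lie below every a_i and drop out.
  split-first : ∀ {m n d} → Recovers (suc m) (λ r → LastNearTop m (2 + n) r × r 0 ≤ 1) d →
                Recovers (suc m) (LastNearTop m n) d →
                Recovers (suc m) (LastNearTop m (2 + n)) (suc d)
  split-first {m} {n} below above = branch 0 1 below (lower-by 2 above drop-two) _,_ _,_
    where
    drop-two : ∀ {r} → LastNearTop m (2 + n) r × 1 < r 0 →
               LastNearTop m n (λ i → r i ∸ 2) × (∀ i → i < suc m → 2 ≤ r i)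
    drop-two (((mono , bounded) , n+2≤rm) , 1<r0) =
      (((λ i≤i' i'≤m → ∸-monoˡ-≤ 2 (mono i≤i' i'≤m)) , (λ i i≤m → ∸-monoˡ-≤ 2 (bounded i i≤m))) ,
        ∸-monoˡ-≤ 2 n+2≤rm) ,
      λ i i≤m → ≤-trans 1<r0 (mono z≤n i≤m)

  record Ladder (m : ℕ) (F : ℕ → Rank → Set) (q d : ℕ) : Set where
    constructor ladder
    field rung : ∀ h → Recovers m (F (q + 2 * h)) (d + h)
  open Ladder public

  climb-ladder : ∀ {m q d} {F : ℕ → Rank → Set} → Recovers m (F q) d →
                 (∀ {h} → Recovers m (F (q + 2 * h)) (d + h) → Recovers m (F (2 + (q + 2 * h))) (suc (d + h))) →
                 Ladder m F q d
  climb-ladder {m} {q} {d} {F} base step = ladder up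
    where
    next : ∀ q h → 2 + (q + 2 * h) ≡ q + 2 * suc h
    next = solve-∀
    up : ∀ h → Recovers m (F (q + 2 * h)) (d + h)
    up zero    = subst₂ (λ n e → Recovers m (F n) e) (sym (+-identityʳ q)) (sym (+-identityʳ d)) base
    up (suc h) = subst₂ (λ n e → Recovers m (F n) e) (next q h) (sym (+-suc d h)) (step (up h))

  ladder-shift : ∀ {m q d} {F : ℕ → Rank → Set} → Ladder m F q d → ∀ s → Ladder m F (q + 2 * s) (d + s)
  ladder-shift {m} {q} {d} {F} L s = ladder λ h →
    subst₂ (λ n e → Recovers m (F n) e) (skip q s h) (sym (+-assoc d s h)) (rung L (s + h))
    where
    skip : ∀ q s h → q + 2 * (s + h) ≡ q + 2 * s + 2 * h
    skip = solve-∀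

  -- M(m+1, n+2) ≤ 1 + max (M(m+1, n), 1 + M(m, n+2))
  climb : ∀ {m q d} → Recovers (suc m) (Interleaving (suc m) q) (suc d) →
          Ladder m (Interleaving m) (2 + q) d → Ladder (suc m) (Interleaving (suc m)) q (suc d)
  climb base L = climb-ladder base λ {h} below → split-last below (settle-last (rung L h))

  clamp : ∀ k → ℕ → Fin (suc k)
  clamp k i = fromℕ< (s≤s (m⊓n≤n i k))

  toℕ-clamp : ∀ k i → toℕ (clamp k i) ≡ i ⊓ k
  toℕ-clamp k i = toℕ-fromℕ< _

  clamp-toℕ : ∀ {k} (x : Fin (suc k)) → clamp k (toℕ x) ≡ x
  clamp-toℕ {k} x = toℕ-injective (trans (toℕ-clamp k (toℕ x)) (m≤n⇒m⊓n≡m (≤-pred (toℕ<n x))))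

  clamp-mono : ∀ k {i i'} → i ≤ i' → toℕ (clamp k i) ≤ toℕ (clamp k i')
  clamp-mono k {i} {i'} i≤i' rewrite toℕ-clamp k i | toℕ-clamp k i' = ⊓-monoˡ-≤ k i≤i'

  module _ {k} (f : Fin k → ℕ) (sorted : ∀ x y → toℕ x < toℕ y → f x < f y) where

    sorted-≤ : ∀ {x y} → toℕ x ≤ toℕ y → f x ≤ f y
    sorted-≤ {x} {y} x≤y with m≤n⇒m<n∨m≡n x≤y
    ... | inj₁ x<y = <⇒≤ (sorted x y x<y)
    ... | inj₂ x≡y rewrite toℕ-injective x≡y = ≤-refl

    sorted-< : ∀ x y → f x < f y ⇔ toℕ x < toℕ y
    sorted-< x y = mk⇔ (λ fx<fy → ≰⇒> λ y≤x → <⇒≱ fx<fy (sorted-≤ y≤x)) (sorted x y)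

  module Ranks {m n : ℕ} (I : Input (suc m) (suc n)) where

    a b : ℕ → ℕ
    a i = val I (inj₁ (clamp m i))
    b j = val I (inj₂ (clamp n j))

    cross-distinct : ∀ x y → val I (inj₁ x) ≢ val I (inj₂ y)
    cross-distinct x y a≡b with distinct I a≡b
    ... | ()

    a≢b : ∀ i j → a i ≢ b j
    a≢b i j = cross-distinct (clamp m i) (clamp n j)

    -- below v k counts the b_j with j < k that are smaller than v (the b's being sorted).
    below : ℕ → ℕ → ℕ
    below v zero    = zero
    below v (suc k) = if b k <ᵇ v then suc k else below v k

    rank : Rank
    rank i = below (a i) (suc n)

    below-≤ : ∀ v k → below v k ≤ k
    below-≤ v zero    = z≤n
    below-≤ v (suc k) with b k <ᵇ v
    ... | true  = ≤-refl
    ... | false = m≤n⇒m≤1+n (below-≤ v k)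

    below-mono : ∀ {v v'} k → v ≤ v' → below v k ≤ below v' k
    below-mono zero v≤v' = z≤n
    below-mono {v} {v'} (suc k) v≤v' with b k <ᵇ v | <ᵇ-reflects-< (b k) v
    ... | true  | ofʸ bk<v rewrite Equivalence.to T-≡ (<⇒<ᵇ (<-≤-trans bk<v v≤v')) = ≤-refl
    ... | false | _ with b k <ᵇ v'
    ...   | true  = m≤n⇒m≤1+n (below-≤ v k)
    ...   | false = below-mono k v≤v'

    below-spec : ∀ i k {j} → j < k → a i < b j ⇔ below (a i) k ≤ j
    below-spec i (suc k) {j} j≤k with b k <ᵇ a i | <ᵇ-reflects-< (b k) (a i)
    ... | true  | ofʸ bk<ai = mk⇔ (λ ai<bj → ⊥-elim (<-asym ai<bj (≤-<-trans bj≤bk bk<ai)))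
                                  (λ k<j → ⊥-elim (<⇒≱ k<j (≤-pred j≤k)))
      where
      bj≤bk : b j ≤ b k
      bj≤bk = sorted-≤ (λ y → val I (inj₂ y)) (b-sorted I) (clamp-mono n (≤-pred j≤k))
    ... | false | ofⁿ bk≮ai with m≤n⇒m<n∨m≡n (≤-pred j≤k)
    ...   | inj₁ j<k  = below-spec i k j<k
    ...   | inj₂ refl = mk⇔ (λ _ → below-≤ (a i) j) (λ _ → ≤∧≢⇒< (≮⇒≥ bk≮ai) (a≢b i j))

    rank-≤ : ∀ i → rank i ≤ suc n
    rank-≤ i = below-≤ (a i) (suc n)

    rank-interleaving : Interleaving (suc m) (suc n) rank
    rank-interleaving =
      (λ i≤i' _ → below-mono (suc n) (sorted-≤ (λ x → val I (inj₁ x)) (a-sorted I) (clamp-mono m i≤i'))) ,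
      (λ i _ → rank-≤ i)

    rank-query : ∀ i {j} → j < suc n → a i < b j ⇔ rank i ≤ j
    rank-query i = below-spec i (suc n)

    rank-queryᵇ : ∀ i {j} → j < suc n → (a i <ᵇ b j) ≡ (rank i ≤ᵇ j)
    rank-queryᵇ i {j} j≤n = reflects-≡ (<ᵇ-reflects-< (a i) (b j)) (≤ᵇ-reflects-≤ (rank i) j)
      (Equivalence.to (rank-query i j≤n)) (Equivalence.from (rank-query i j≤n))

    a-below-b : ∀ x y → val I (inj₁ x) < val I (inj₂ y) ⇔ rank (toℕ x) ≤ toℕ y
    a-below-b x y =
      subst₂ (λ x' y' → val I (inj₁ x') < val I (inj₂ y') ⇔ rank (toℕ x) ≤ toℕ y)
             (clamp-toℕ x) (clamp-toℕ y) (rank-query (toℕ x) (toℕ<n y))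

    b-below-a : ∀ x y → val I (inj₂ y) < val I (inj₁ x) ⇔ toℕ y < rank (toℕ x)
    b-below-a x y = mk⇔
      (λ b<a → ≰⇒> λ rank≤y → <-asym b<a (Equivalence.from (a-below-b x y) rank≤y))
      (λ y<rank → ≤∧≢⇒< (≮⇒≥ λ a<b → <⇒≱ y<rank (Equivalence.to (a-below-b x y) a<b))
                        (cross-distinct x y ∘ sym))

  open Ranks using (rank; rank-≤; rank-interleaving; rank-queryᵇ; a-below-b; b-below-a)

  same-ranks⇒same-order : ∀ {m n} (I J : Input (suc m) (suc n)) →
                          (∀ i → i < suc m → rank I i ≡ rank J i) → SameOrder I J
  same-ranks⇒same-order I J same (inj₁ x) (inj₁ x') =
    ⇔.trans (sorted-< _ (a-sorted I) x x') (⇔.sym (sorted-< _ (a-sorted J) x x'))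
  same-ranks⇒same-order I J same (inj₂ y) (inj₂ y') =
    ⇔.trans (sorted-< _ (b-sorted I) y y') (⇔.sym (sorted-< _ (b-sorted J) y y'))
  same-ranks⇒same-order I J same (inj₁ x) (inj₂ y) =
    ⇔.trans (a-below-b I x y)
      (subst (λ ρ → ρ ≤ toℕ y ⇔ _) (sym (same (toℕ x) (toℕ<n x))) (⇔.sym (a-below-b J x y)))
  same-ranks⇒same-order I J same (inj₂ y) (inj₁ x) =
    ⇔.trans (b-below-a I x y)
      (subst (λ ρ → toℕ y < ρ ⇔ _) (sym (same (toℕ x) (toℕ<n x))) (⇔.sym (b-below-a J x y)))

  module _ {m n : ℕ} where

    -- Questions r i ≤ j with j > n are answered yes at no cost; a question about i > m
    -- compares a_m, matching  rank , which clamps its argument at m.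
    toTree : Strategy → Tree (suc m) (suc n)
    toTree (answer _)    = leaf
    toTree (ask i j s t) with j <? suc n
    ... | yes _ = node (inj₁ (clamp m i)) (inj₂ (clamp n j)) (toTree s) (toTree t)
    ... | no  _ = toTree s

    decode : Strategy → List Bool → Rank
    decode (answer f)    _  = f
    decode (ask i j s t) bs with j <? suc n | bs
    ... | yes _ | true  ∷ bs' = decode s bs'
    ... | yes _ | false ∷ bs' = decode t bs'
    ... | yes _ | []          = λ _ → 0
    ... | no  _ | _           = decode s bs

    run-length : ∀ s (I : Input (suc m) (suc n)) → length (run (toTree s) I) ≤ depth s
    run-length (answer _)    I = z≤n
    run-length (ask i j s t) I with j <? suc n
    ... | no  _ = ≤-trans (run-length s I) (m≤n⇒m≤1+n (m≤m⊔n _ _))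
    ... | yes _ with val I (inj₁ (clamp m i)) <ᵇ val I (inj₂ (clamp n j))
    ...   | true  = s≤s (≤-trans (run-length s I) (m≤m⊔n _ _))
    ...   | false = s≤s (≤-trans (run-length t I) (m≤n⊔m _ _))

    decode-run : ∀ s (I : Input (suc m) (suc n)) {r : Rank} →
                 (∀ i {j} → j < suc n → (val I (inj₁ (clamp m i)) <ᵇ val I (inj₂ (clamp n j))) ≡ (r i ≤ᵇ j)) →
                 (∀ i {j} → suc n ≤ j → r i ≤ j) →
                 decode s (run (toTree s) I) ≡ decide s r
    decode-run (answer _)    I         queries beyond = refl
    decode-run (ask i j s t) I {r} queries beyond with j <? suc n
    ... | no j≰n with r i ≤ᵇ j | ≤ᵇ-reflects-≤ (r i) j
    ...   | true  | _        = decode-run s I queries beyond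
    ...   | false | ofⁿ ri≰j = ⊥-elim (ri≰j (beyond i (≮⇒≥ j≰n)))
    decode-run (ask i j s t) I {r} queries beyond | yes j≤n
      with val I (inj₁ (clamp m i)) <ᵇ val I (inj₂ (clamp n j)) | r i ≤ᵇ j | queries i j≤n
    ... | true  | true  | refl = decode-run s I queries beyond
    ... | false | false | refl = decode-run t I queries beyond

  M≤-from-recovers : ∀ {m n c} → Recovers (suc m) (Interleaving (suc m) (suc n)) c → M≤ (suc m) (suc n) c
  M≤-from-recovers {m} {n} (s , ds , cs) =
    toTree s , sorts , λ I → ≤-trans (run-length s I) ds
    where
    outcome : List Bool → Rank
    outcome = decode {m} {n} s
    decode-rank : ∀ I → outcome (run (toTree s) I) ≡ decide s (rank I)
    decode-rank I = decode-run s I (rank-queryᵇ I) λ i n<j → ≤-trans (rank-≤ I i) n<j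
    sorts : Sorts (toTree s)
    sorts I J same-run = same-ranks⇒same-order I J λ i i≤m →
      begin
        rank I i                               ≡⟨ cs (rank I) (rank-interleaving I) i i≤m ⟨
        decide s (rank I) i                    ≡⟨ cong (λ ρ → ρ i) (decode-rank I) ⟨
        outcome (run (toTree s) I) i           ≡⟨ cong (λ bs → outcome bs i) same-run ⟩
        outcome (run (toTree s) J) i           ≡⟨ cong (λ ρ → ρ i) (decode-rank J) ⟩
        decide s (rank J) i                    ≡⟨ cs (rank J) (rank-interleaving J) i i≤m ⟩
        rank J i                               ∎
      where open ≡-Reasoning

  -- Found by computer search.
  tree-1-7 tree-2-11 tree-3-13 tree-near-top-6 tree-near-top-first-8 tree-near-top-first-10 : Certificate
  tree-1-7 = cmp 0 3 (cmp 0 1 (cmp 0 0 done done) (cmp 0 2 done done)) (cmp 0 5 (cmp 0 4 done done) (cmp 0 6 done done))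
  tree-2-11 = cmp 0 2 (cmp 0 0 (cmp 1 0 done (cmp 1 3 (cmp 1 1 done (cmp 1 2 done done)) (cmp 1 7 (cmp 1 5 (cmp 1 4 done done) (cmp 1 6 done done)) (cmp 1 9 (cmp 1 8 done done) (cmp 1 10 done done))))) (cmp 0 1 (cmp 1 3 (cmp 1 1 done (cmp 1 2 done done)) (cmp 1 7 (cmp 1 5 (cmp 1 4 done done) (cmp 1 6 done done)) (cmp 1 9 (cmp 1 8 done done) (cmp 1 10 done done)))) (cmp 1 3 (cmp 1 2 done done) (cmp 1 7 (cmp 1 5 (cmp 1 4 done done) (cmp 1 6 done done)) (cmp 1 9 (cmp 1 8 done done) (cmp 1 10 done done)))))) (cmp 0 5 (cmp 0 3 (cmp 1 3 done (cmp 1 7 (cmp 1 5 (cmp 1 4 done done) (cmp 1 6 done done)) (cmp 1 9 (cmp 1 8 done done) (cmp 1 10 done done)))) (cmp 0 4 (cmp 1 7 (cmp 1 5 (cmp 1 4 done done) (cmp 1 6 done done)) (cmp 1 9 (cmp 1 8 done done) (cmp 1 10 done done))) (cmp 1 7 (cmp 1 5 done (cmp 1 6 done done)) (cmp 1 9 (cmp 1 8 done done) (cmp 1 10 done done))))) (cmp 0 7 (cmp 0 6 (cmp 1 7 (cmp 1 6 done done) (cmp 1 9 (cmp 1 8 done done) (cmp 1 10 done done))) (cmp 1 7 done (cmp 1 9 (cmp 1 8 done done) (cmp 1 10 done done)))) (cmp 0 8 (cmp 1 8 done (cmp 1 9 done (cmp 1 10 done done))) (cmp 0 9 (cmp 1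 9 done (cmp 1 10 done done)) (cmp 0 10 (cmp 1 10 done done) done)))))
  tree-3-13 = cmp 0 2 (cmp 0 0 (cmp 1 0 (cmp 2 0 done (cmp 2 1 done (cmp 2 2 done (cmp 2 5 (cmp 2 3 done (cmp 2 4 done done)) (cmp 2 9 (cmp 2 7 (cmp 2 6 done done) (cmp 2 8 done done)) (cmp 2 11 (cmp 2 10 done done) (cmp 2 12 done done))))))) (cmp 1 4 (cmp 1 2 (cmp 1 1 (cmp 2 5 (cmp 2 1 done (cmp 2 3 (cmp 2 2 done done) (cmp 2 4 done done))) (cmp 2 9 (cmp 2 7 (cmp 2 6 done done) (cmp 2 8 done done)) (cmp 2 11 (cmp 2 10 done done) (cmp 2 12 done done)))) (cmp 2 5 (cmp 2 2 done (cmp 2 3 done (cmp 2 4 done done))) (cmp 2 9 (cmp 2 7 (cmp 2 6 done done) (cmp 2 8 done done)) (cmp 2 11 (cmp 2 10 done done) (cmp 2 12 done done))))) (cmp 1 3 (cmp 2 5 (cmp 2 3 done (cmp 2 4 done done)) (cmp 2 9 (cmp 2 7 (cmp 2 6 done done) (cmp 2 8 done done)) (cmp 2 11 (cmp 2 10 done done) (cmp 2 12 done done)))) (cmp 2 5 (cmp 2 4 done done) (cmp 2 9 (cmp 2 7 (cmp 2 6 done done) (cmp 2 8 done done)) (cmp 2 11 (cmp 2 10 done done) (cmp 2 12 done done)))))) (cmp 1 7 (cmp 1 5 (cmp 2 5 done (cmp 2 9 (cmp 2 7 (cmp 2 6 done done) (cmp 2 8 done done)) (cmp 2 11 (cmp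 2 10 done done) (cmp 2 12 done done)))) (cmp 1 6 (cmp 2 9 (cmp 2 7 (cmp 2 6 done done) (cmp 2 8 done done)) (cmp 2 11 (cmp 2 10 done done) (cmp 2 12 done done))) (cmp 2 9 (cmp 2 7 done (cmp 2 8 done done)) (cmp 2 11 (cmp 2 10 done done) (cmp 2 12 done done))))) (cmp 1 9 (cmp 1 8 (cmp 2 9 (cmp 2 8 done done) (cmp 2 11 (cmp 2 10 done done) (cmp 2 12 done done))) (cmp 2 9 done (cmp 2 11 (cmp 2 10 done done) (cmp 2 12 done done)))) (cmp 1 10 (cmp 2 10 done (cmp 2 11 done (cmp 2 12 done done))) (cmp 1 11 (cmp 2 11 done (cmp 2 12 done done)) (cmp 1 12 (cmp 2 12 done done) done))))))) (cmp 0 1 (cmp 1 4 (cmp 1 2 (cmp 1 1 (cmp 2 5 (cmp 2 1 done (cmp 2 3 (cmp 2 2 done done) (cmp 2 4 done done))) (cmp 2 9 (cmp 2 7 (cmp 2 6 done done) (cmp 2 8 done done)) (cmp 2 11 (cmp 2 10 done done) (cmp 2 12 done done)))) (cmp 2 5 (cmp 2 2 done (cmp 2 3 done (cmp 2 4 done done))) (cmp 2 9 (cmp 2 7 (cmp 2 6 done done) (cmp 2 8 done done)) (cmp 2 11 (cmp 2 10 done done) (cmp 2 12 done done))))) (cmp 1 3 (cmp 2 5 (cmp 2 3 done (cmp 2 4 done done)) (cmp 2 9 (cmp 2 7 (cmp 2 6 done done) (cmp 2 8 done done)) (cmp 2 11 (cmp 2 10 done done) (cmp 2 12 done done)))) (cmp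 2 5 (cmp 2 4 done done) (cmp 2 9 (cmp 2 7 (cmp 2 6 done done) (cmp 2 8 done done)) (cmp 2 11 (cmp 2 10 done done) (cmp 2 12 done done)))))) (cmp 1 7 (cmp 1 5 (cmp 2 5 done (cmp 2 9 (cmp 2 7 (cmp 2 6 done done) (cmp 2 8 done done)) (cmp 2 11 (cmp 2 10 done done) (cmp 2 12 done done)))) (cmp 1 6 (cmp 2 9 (cmp 2 7 (cmp 2 6 done done) (cmp 2 8 done done)) (cmp 2 11 (cmp 2 10 done done) (cmp 2 12 done done))) (cmp 2 9 (cmp 2 7 done (cmp 2 8 done done)) (cmp 2 11 (cmp 2 10 done done) (cmp 2 12 done done))))) (cmp 1 9 (cmp 1 8 (cmp 2 9 (cmp 2 8 done done) (cmp 2 11 (cmp 2 10 done done) (cmp 2 12 done done))) (cmp 2 9 done (cmp 2 11 (cmp 2 10 done done) (cmp 2 12 done done)))) (cmp 1 10 (cmp 2 10 done (cmp 2 11 done (cmp 2 12 done done))) (cmp 1 11 (cmp 2 11 done (cmp 2 12 done done)) (cmp 1 12 (cmp 2 12 done done) done)))))) (cmp 1 4 (cmp 1 2 (cmp 2 2 done (cmp 2 5 (cmp 2 3 done (cmp 2 4 done done)) (cmp 2 9 (cmp 2 7 (cmp 2 6 done done) (cmp 2 8 done done)) (cmp 2 11 (cmp 2 10 done done) (cmp 2 12 done done))))) (cmp 1 3 (cmp 2 5 (cmp 2 3 done (cmp 2 4 done done)) (cmp 2 9 (cmp 2 7 (cmp 2 6 done done) (cmp 2 8 done done)) (cmp 2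 11 (cmp 2 10 done done) (cmp 2 12 done done)))) (cmp 2 5 (cmp 2 4 done done) (cmp 2 9 (cmp 2 7 (cmp 2 6 done done) (cmp 2 8 done done)) (cmp 2 11 (cmp 2 10 done done) (cmp 2 12 done done)))))) (cmp 1 7 (cmp 1 5 (cmp 2 5 done (cmp 2 9 (cmp 2 7 (cmp 2 6 done done) (cmp 2 8 done done)) (cmp 2 11 (cmp 2 10 done done) (cmp 2 12 done done)))) (cmp 1 6 (cmp 2 9 (cmp 2 7 (cmp 2 6 done done) (cmp 2 8 done done)) (cmp 2 11 (cmp 2 10 done done) (cmp 2 12 done done))) (cmp 2 9 (cmp 2 7 done (cmp 2 8 done done)) (cmp 2 11 (cmp 2 10 done done) (cmp 2 12 done done))))) (cmp 1 9 (cmp 1 8 (cmp 2 9 (cmp 2 8 done done) (cmp 2 11 (cmp 2 10 done done) (cmp 2 12 done done))) (cmp 2 9 done (cmp 2 11 (cmp 2 10 done done) (cmp 2 12 done done)))) (cmp 1 10 (cmp 2 10 done (cmp 2 11 done (cmp 2 12 done done))) (cmp 1 11 (cmp 2 11 done (cmp 2 12 done done)) (cmp 1 12 (cmp 2 12 done done) done)))))))) (cmp 0 4 (cmp 0 3 (cmp 1 4 (cmp 1 3 (cmp 2 3 done (cmp 2 5 (cmp 2 4 done done) (cmp 2 9 (cmp 2 7 (cmp 2 6 done done) (cmp 2 8 done done)) (cmp 2 11 (cmp 2 10 done done) (cmp 2 12 done done))))) (cmp 2 4 done (cmp 2 5 done (cmp 2 9 (cmp 2 7 (cmp 2 6 done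 done) (cmp 2 8 done done)) (cmp 2 11 (cmp 2 10 done done) (cmp 2 12 done done)))))) (cmp 1 7 (cmp 1 5 (cmp 2 5 done (cmp 2 9 (cmp 2 7 (cmp 2 6 done done) (cmp 2 8 done done)) (cmp 2 11 (cmp 2 10 done done) (cmp 2 12 done done)))) (cmp 1 6 (cmp 2 9 (cmp 2 7 (cmp 2 6 done done) (cmp 2 8 done done)) (cmp 2 11 (cmp 2 10 done done) (cmp 2 12 done done))) (cmp 2 9 (cmp 2 7 done (cmp 2 8 done done)) (cmp 2 11 (cmp 2 10 done done) (cmp 2 12 done done))))) (cmp 1 9 (cmp 1 8 (cmp 2 9 (cmp 2 8 done done) (cmp 2 11 (cmp 2 10 done done) (cmp 2 12 done done))) (cmp 2 9 done (cmp 2 11 (cmp 2 10 done done) (cmp 2 12 done done)))) (cmp 1 10 (cmp 2 10 done (cmp 2 11 done (cmp 2 12 done done))) (cmp 1 11 (cmp 2 11 done (cmp 2 12 done done)) (cmp 1 12 (cmp 2 12 done done) done)))))) (cmp 1 4 (cmp 2 4 done (cmp 2 5 done (cmp 2 6 done (cmp 2 9 (cmp 2 7 done (cmp 2 8 done done)) (cmp 2 11 (cmp 2 10 done done) (cmp 2 12 done done)))))) (cmp 1 7 (cmp 1 5 (cmp 2 5 done (cmp 2 9 (cmp 2 7 (cmp 2 6 done done) (cmp 2 8 done done)) (cmp 2 11 (cmp 2 10 done done) (cmp 2 12 done done)))) (cmp 1 6 (cmp 2 9 (cmp 2 7 (cmp 2 6 done done) (cmp 2 8 done done)) (cmp 2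 11 (cmp 2 10 done done) (cmp 2 12 done done))) (cmp 2 9 (cmp 2 7 done (cmp 2 8 done done)) (cmp 2 11 (cmp 2 10 done done) (cmp 2 12 done done))))) (cmp 1 9 (cmp 1 8 (cmp 2 9 (cmp 2 8 done done) (cmp 2 11 (cmp 2 10 done done) (cmp 2 12 done done))) (cmp 2 9 done (cmp 2 11 (cmp 2 10 done done) (cmp 2 12 done done)))) (cmp 1 10 (cmp 2 10 done (cmp 2 11 done (cmp 2 12 done done))) (cmp 1 11 (cmp 2 11 done (cmp 2 12 done done)) (cmp 1 12 (cmp 2 12 done done) done))))))) (cmp 0 6 (cmp 0 5 (cmp 1 7 (cmp 1 5 (cmp 2 5 done (cmp 2 9 (cmp 2 7 (cmp 2 6 done done) (cmp 2 8 done done)) (cmp 2 11 (cmp 2 10 done done) (cmp 2 12 done done)))) (cmp 1 6 (cmp 2 9 (cmp 2 7 (cmp 2 6 done done) (cmp 2 8 done done)) (cmp 2 11 (cmp 2 10 done done) (cmp 2 12 done done))) (cmp 2 9 (cmp 2 7 done (cmp 2 8 done done)) (cmp 2 11 (cmp 2 10 done done) (cmp 2 12 done done))))) (cmp 1 9 (cmp 1 8 (cmp 2 9 (cmp 2 8 done done) (cmp 2 11 (cmp 2 10 done done) (cmp 2 12 done done))) (cmp 2 9 done (cmp 2 11 (cmp 2 10 done done) (cmp 2 12 done done)))) (cmp 1 10 (cmp 2 10 done (cmp 2 11 done (cmp 2 12 done done))) (cmp 1 11 (cmp 2 11 done (cmp 2 12 done done)) (cmp 1 12 (cmp 2 12 done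 done) done))))) (cmp 1 7 (cmp 1 6 (cmp 2 6 done (cmp 2 9 (cmp 2 7 done (cmp 2 8 done done)) (cmp 2 11 (cmp 2 10 done done) (cmp 2 12 done done)))) (cmp 2 7 done (cmp 2 9 (cmp 2 8 done done) (cmp 2 11 (cmp 2 10 done done) (cmp 2 12 done done))))) (cmp 1 9 (cmp 1 8 (cmp 2 9 (cmp 2 8 done done) (cmp 2 11 (cmp 2 10 done done) (cmp 2 12 done done))) (cmp 2 9 done (cmp 2 11 (cmp 2 10 done done) (cmp 2 12 done done)))) (cmp 1 10 (cmp 2 10 done (cmp 2 11 done (cmp 2 12 done done))) (cmp 1 11 (cmp 2 11 done (cmp 2 12 done done)) (cmp 1 12 (cmp 2 12 done done) done)))))) (cmp 0 8 (cmp 2 11 (cmp 1 8 (cmp 1 7 (cmp 2 7 done (cmp 2 9 (cmp 2 8 done done) (cmp 2 10 done done))) (cmp 0 7 (cmp 2 9 (cmp 2 8 done done) (cmp 2 10 done done)) (cmp 2 9 (cmp 2 8 done done) (cmp 2 10 done done)))) (cmp 0 7 (cmp 1 9 (cmp 2 9 done (cmp 2 10 done done)) (cmp 1 10 (cmp 2 10 done done) done)) (cmp 1 9 (cmp 2 9 done (cmp 2 10 done done)) (cmp 1 10 (cmp 2 10 done done) done)))) (cmp 0 7 (cmp 1 9 (cmp 1 7 (cmp 2 12 done done) (cmp 1 8 (cmp 2 12 done done) (cmp 2 12 done done))) (cmp 1 11 (cmp 1 10 (cmp 2 12 done done) (cmp 2 12 done done)) (cmp 1 12 (cmp 2 12 done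 done) done))) (cmp 1 9 (cmp 1 8 (cmp 2 12 done done) (cmp 2 12 done done)) (cmp 1 11 (cmp 1 10 (cmp 2 12 done done) (cmp 2 12 done done)) (cmp 1 12 (cmp 2 12 done done) done))))) (cmp 0 9 (cmp 1 9 (cmp 2 9 done (cmp 2 10 done (cmp 2 11 done (cmp 2 12 done done)))) (cmp 1 10 (cmp 2 10 done (cmp 2 11 done (cmp 2 12 done done))) (cmp 1 11 (cmp 2 11 done (cmp 2 12 done done)) (cmp 1 12 (cmp 2 12 done done) done)))) (cmp 0 10 (cmp 1 10 (cmp 2 10 done (cmp 2 11 done (cmp 2 12 done done))) (cmp 1 11 (cmp 2 11 done (cmp 2 12 done done)) (cmp 1 12 (cmp 2 12 done done) done))) (cmp 0 11 (cmp 1 11 (cmp 2 11 done (cmp 2 12 done done)) (cmp 1 12 (cmp 2 12 done done) done)) (cmp 0 12 (cmp 1 12 (cmp 2 12 done done) done) done)))))))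
  tree-near-top-6 = cmp 3 5 (cmp 0 0 (cmp 1 0 (cmp 2 0 (cmp 3 0 (cmp 4 6 done done) (cmp 3 1 (cmp 4 6 done done) (cmp 3 2 (cmp 4 6 done done) (cmp 3 3 (cmp 4 6 done done) (cmp 3 4 (cmp 4 6 done done) (cmp 4 6 done done)))))) (cmp 2 1 (cmp 3 1 (cmp 4 6 done done) (cmp 3 2 (cmp 4 6 done done) (cmp 3 3 (cmp 4 6 done done) (cmp 3 4 (cmp 4 6 done done) (cmp 4 6 done done))))) (cmp 2 2 (cmp 3 2 (cmp 4 6 done done) (cmp 3 3 (cmp 4 6 done done) (cmp 3 4 (cmp 4 6 done done) (cmp 4 6 done done)))) (cmp 2 3 (cmp 3 3 (cmp 4 6 done done) (cmp 3 4 (cmp 4 6 done done) (cmp 4 6 done done))) (cmp 2 4 (cmp 3 4 (cmp 4 6 done done) (cmp 4 6 done done)) (cmp 4 6 done done)))))) (cmp 1 1 (cmp 2 1 (cmp 3 1 (cmp 4 6 done done) (cmp 3 2 (cmp 4 6 done done) (cmp 3 3 (cmp 4 6 done done) (cmp 3 4 (cmp 4 6 done done) (cmp 4 6 done done))))) (cmp 2 2 (cmp 3 2 (cmp 4 6 done done) (cmp 3 3 (cmp 4 6 done done) (cmp 3 4 (cmp 4 6 done done) (cmp 4 6 done done)))) (cmp 2 3 (cmp 3 3 (cmp 4 6 done done) (cmp 3 4 (cmp 4 6 done done) (cmp 4 6 done done))) (cmp 2 4 (cmp 3 4 (cmp 4 6 done done) (cmp 4 6 done done)) (cmp 4 6 done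 done))))) (cmp 1 2 (cmp 2 2 (cmp 3 2 (cmp 4 6 done done) (cmp 3 3 (cmp 4 6 done done) (cmp 3 4 (cmp 4 6 done done) (cmp 4 6 done done)))) (cmp 2 3 (cmp 3 3 (cmp 4 6 done done) (cmp 3 4 (cmp 4 6 done done) (cmp 4 6 done done))) (cmp 2 4 (cmp 3 4 (cmp 4 6 done done) (cmp 4 6 done done)) (cmp 4 6 done done)))) (cmp 1 3 (cmp 2 3 (cmp 3 3 (cmp 4 6 done done) (cmp 3 4 (cmp 4 6 done done) (cmp 4 6 done done))) (cmp 2 4 (cmp 3 4 (cmp 4 6 done done) (cmp 4 6 done done)) (cmp 4 6 done done))) (cmp 1 4 (cmp 2 4 (cmp 3 4 (cmp 4 6 done done) (cmp 4 6 done done)) (cmp 4 6 done done)) (cmp 4 6 done done)))))) (cmp 0 1 (cmp 1 1 (cmp 2 1 (cmp 3 1 (cmp 4 6 done done) (cmp 3 2 (cmp 4 6 done done) (cmp 3 3 (cmp 4 6 done done) (cmp 3 4 (cmp 4 6 done done) (cmp 4 6 done done))))) (cmp 2 2 (cmp 3 2 (cmp 4 6 done done) (cmp 3 3 (cmp 4 6 done done) (cmp 3 4 (cmp 4 6 done done) (cmp 4 6 done done)))) (cmp 2 3 (cmp 3 3 (cmp 4 6 done done) (cmp 3 4 (cmp 4 6 done done) (cmp 4 6 done done))) (cmp 2 4 (cmp 3 4 (cmp 4 6 done done) (cmp 4 6 done done)) (cmp 4 6 done done))))) (cmp 1 2 (cmp 2 2 (cmp 3 2 (cmp 4 6 done done)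 (cmp 3 3 (cmp 4 6 done done) (cmp 3 4 (cmp 4 6 done done) (cmp 4 6 done done)))) (cmp 2 3 (cmp 3 3 (cmp 4 6 done done) (cmp 3 4 (cmp 4 6 done done) (cmp 4 6 done done))) (cmp 2 4 (cmp 3 4 (cmp 4 6 done done) (cmp 4 6 done done)) (cmp 4 6 done done)))) (cmp 1 3 (cmp 2 3 (cmp 3 3 (cmp 4 6 done done) (cmp 3 4 (cmp 4 6 done done) (cmp 4 6 done done))) (cmp 2 4 (cmp 3 4 (cmp 4 6 done done) (cmp 4 6 done done)) (cmp 4 6 done done))) (cmp 1 4 (cmp 2 4 (cmp 3 4 (cmp 4 6 done done) (cmp 4 6 done done)) (cmp 4 6 done done)) (cmp 4 6 done done))))) (cmp 0 2 (cmp 1 2 (cmp 2 2 (cmp 3 2 (cmp 4 6 done done) (cmp 3 3 (cmp 4 6 done done) (cmp 3 4 (cmp 4 6 done done) (cmp 4 6 done done)))) (cmp 2 3 (cmp 3 3 (cmp 4 6 done done) (cmp 3 4 (cmp 4 6 done done) (cmp 4 6 done done))) (cmp 2 4 (cmp 3 4 (cmp 4 6 done done) (cmp 4 6 done done)) (cmp 4 6 done done)))) (cmp 1 3 (cmp 2 3 (cmp 3 3 (cmp 4 6 done done) (cmp 3 4 (cmp 4 6 done done) (cmp 4 6 done done))) (cmp 2 4 (cmp 3 4 (cmp 4 6 done done) (cmp 4 6 done done)) (cmp 4 6 done done))) (cmp 1 4 (cmp 2 4 (cmp 3 4 (cmp 4 6 done done) (cmp 4 6 done done)) (cmp 4 6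 done done)) (cmp 4 6 done done)))) (cmp 0 3 (cmp 1 3 (cmp 2 3 (cmp 3 3 (cmp 4 6 done done) (cmp 3 4 (cmp 4 6 done done) (cmp 4 6 done done))) (cmp 2 4 (cmp 3 4 (cmp 4 6 done done) (cmp 4 6 done done)) (cmp 4 6 done done))) (cmp 1 4 (cmp 2 4 (cmp 3 4 (cmp 4 6 done done) (cmp 4 6 done done)) (cmp 4 6 done done)) (cmp 4 6 done done))) (cmp 0 4 (cmp 1 4 (cmp 2 4 (cmp 3 4 (cmp 4 6 done done) (cmp 4 6 done done)) (cmp 4 6 done done)) (cmp 4 6 done done)) (cmp 4 6 done done)))))) (cmp 0 1 (cmp 2 4 (cmp 1 1 (cmp 1 0 (cmp 2 0 (cmp 3 6 (cmp 4 6 done done) done) (cmp 2 2 (cmp 2 1 (cmp 3 6 (cmp 4 6 done done) done) (cmp 3 6 (cmp 4 6 done done) done)) (cmp 2 3 (cmp 3 6 (cmp 4 6 done done) done) (cmp 3 6 (cmp 4 6 done done) done)))) (cmp 0 0 (cmp 2 2 (cmp 2 1 (cmp 3 6 (cmp 4 6 done done) done) (cmp 3 6 (cmp 4 6 done done) done)) (cmp 2 3 (cmp 3 6 (cmp 4 6 done done) done) (cmp 3 6 (cmp 4 6 done done) done))) (cmp 2 2 (cmp 2 1 (cmp 3 6 (cmp 4 6 done done) done) (cmp 3 6 (cmp 4 6 done done) done)) (cmp 2 3 (cmp 3 6 (cmp 4 6 done done) done) (cmp 3 6 (cmp 4 6 done done) done))))) (cmp 0 0 (cmp 1 2 (cmp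 2 2 (cmp 3 6 (cmp 4 6 done done) done) (cmp 2 3 (cmp 3 6 (cmp 4 6 done done) done) (cmp 3 6 (cmp 4 6 done done) done))) (cmp 1 3 (cmp 2 3 (cmp 3 6 (cmp 4 6 done done) done) (cmp 3 6 (cmp 4 6 done done) done)) (cmp 3 6 (cmp 4 6 done done) done))) (cmp 1 2 (cmp 2 2 (cmp 3 6 (cmp 4 6 done done) done) (cmp 2 3 (cmp 3 6 (cmp 4 6 done done) done) (cmp 3 6 (cmp 4 6 done done) done))) (cmp 1 3 (cmp 2 3 (cmp 3 6 (cmp 4 6 done done) done) (cmp 3 6 (cmp 4 6 done done) done)) (cmp 3 6 (cmp 4 6 done done) done))))) (cmp 0 0 (cmp 1 2 (cmp 1 0 (cmp 2 5 (cmp 3 6 (cmp 4 6 done done) done) (cmp 2 6 (cmp 3 6 (cmp 4 6 done done) done) done)) (cmp 1 1 (cmp 2 5 (cmp 3 6 (cmp 4 6 done done) done) (cmp 3 6 (cmp 4 6 done done) (cmp 2 6 done done))) (cmp 2 5 (cmp 3 6 (cmp 4 6 done done) done) (cmp 3 6 (cmp 4 6 done done) (cmp 2 6 done done))))) (cmp 1 4 (cmp 1 3 (cmp 2 5 (cmp 3 6 (cmp 4 6 done done) done) (cmp 3 6 (cmp 4 6 done done) (cmp 2 6 done done))) (cmp 2 5 (cmp 3 6 (cmp 4 6 done done) done) (cmp 3 6 (cmp 4 6 done done) (cmp 2 6 done done)))) (cmp 1 5 (cmp 2 5 (cmp 3 6 (cmp 4 6 done done) done) (cmp 3 6 (cmp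 4 6 done done) (cmp 2 6 done done))) (cmp 1 6 (cmp 3 6 (cmp 4 6 done done) (cmp 2 6 done done)) done)))) (cmp 1 2 (cmp 1 1 (cmp 2 5 (cmp 3 6 (cmp 4 6 done done) done) (cmp 2 6 (cmp 3 6 (cmp 4 6 done done) done) done)) (cmp 2 5 (cmp 3 6 (cmp 4 6 done done) done) (cmp 2 6 (cmp 3 6 (cmp 4 6 done done) done) done))) (cmp 1 4 (cmp 1 3 (cmp 2 5 (cmp 3 6 (cmp 4 6 done done) done) (cmp 3 6 (cmp 4 6 done done) (cmp 2 6 done done))) (cmp 2 5 (cmp 3 6 (cmp 4 6 done done) done) (cmp 3 6 (cmp 4 6 done done) (cmp 2 6 done done)))) (cmp 1 5 (cmp 2 5 (cmp 3 6 (cmp 4 6 done done) done) (cmp 3 6 (cmp 4 6 done done) (cmp 2 6 done done))) (cmp 1 6 (cmp 3 6 (cmp 4 6 done done) (cmp 2 6 done done)) done)))))) (cmp 0 2 (cmp 1 2 (cmp 2 2 (cmp 3 6 (cmp 4 6 done done) done) (cmp 2 3 (cmp 3 6 (cmp 4 6 done done) done) (cmp 2 4 (cmp 3 6 (cmp 4 6 done done) done) (cmp 2 5 (cmp 3 6 (cmp 4 6 done done) done) (cmp 3 6 (cmp 4 6 done done) (cmp 2 6 done done)))))) (cmp 1 3 (cmp 2 3 (cmp 3 6 (cmp 4 6 done done) done) (cmp 2 4 (cmp 3 6 (cmp 4 6 done done) done) (cmp 2 5 (cmp 3 6 (cmp 4 6 done done) done) (cmp 3 6 (cmp 4 6 done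 done) (cmp 2 6 done done))))) (cmp 1 4 (cmp 2 4 (cmp 3 6 (cmp 4 6 done done) done) (cmp 2 5 (cmp 3 6 (cmp 4 6 done done) done) (cmp 3 6 (cmp 4 6 done done) (cmp 2 6 done done)))) (cmp 1 5 (cmp 2 5 (cmp 3 6 (cmp 4 6 done done) done) (cmp 3 6 (cmp 4 6 done done) (cmp 2 6 done done))) (cmp 1 6 (cmp 3 6 (cmp 4 6 done done) (cmp 2 6 done done)) done))))) (cmp 0 3 (cmp 1 3 (cmp 2 3 (cmp 3 6 (cmp 4 6 done done) done) (cmp 2 4 (cmp 3 6 (cmp 4 6 done done) done) (cmp 2 5 (cmp 3 6 (cmp 4 6 done done) done) (cmp 3 6 (cmp 4 6 done done) (cmp 2 6 done done))))) (cmp 1 4 (cmp 2 4 (cmp 3 6 (cmp 4 6 done done) done) (cmp 2 5 (cmp 3 6 (cmp 4 6 done done) done) (cmp 3 6 (cmp 4 6 done done) (cmp 2 6 done done)))) (cmp 1 5 (cmp 2 5 (cmp 3 6 (cmp 4 6 done done) done) (cmp 3 6 (cmp 4 6 done done) (cmp 2 6 done done))) (cmp 1 6 (cmp 3 6 (cmp 4 6 done done) (cmp 2 6 done done)) done)))) (cmp 0 4 (cmp 1 4 (cmp 2 4 (cmp 3 6 (cmp 4 6 done done) done) (cmp 2 5 (cmp 3 6 (cmp 4 6 done done) done) (cmp 3 6 (cmp 4 6 done done) (cmp 2 6 done done)))) (cmp 1 5 (cmp 2 5 (cmp 3 6 (cmp 4 6 done done) done) (cmp 3 6 (cmp 4 6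 done done) (cmp 2 6 done done))) (cmp 1 6 (cmp 3 6 (cmp 4 6 done done) (cmp 2 6 done done)) done))) (cmp 0 5 (cmp 1 5 (cmp 2 5 (cmp 3 6 (cmp 4 6 done done) done) (cmp 3 6 (cmp 4 6 done done) (cmp 2 6 done done))) (cmp 1 6 (cmp 3 6 (cmp 4 6 done done) (cmp 2 6 done done)) done)) (cmp 0 6 (cmp 1 6 (cmp 3 6 (cmp 4 6 done done) (cmp 2 6 done done)) done) done))))))
  tree-near-top-first-8 = cmp 2 4 (cmp 1 1 (cmp 1 0 (cmp 2 0 (cmp 3 0 (cmp 4 8 done done) (cmp 3 1 (cmp 4 8 done done) (cmp 3 5 (cmp 3 3 (cmp 3 2 (cmp 4 8 done done) (cmp 4 8 done done)) (cmp 3 4 (cmp 4 8 done done) (cmp 4 8 done done))) (cmp 3 7 (cmp 3 6 (cmp 4 8 done done) (cmp 4 8 done done)) (cmp 3 8 (cmp 4 8 done done) done))))) (cmp 3 5 (cmp 3 3 (cmp 2 1 (cmp 3 1 (cmp 4 8 done done) (cmp 3 2 (cmp 4 8 done done) (cmp 4 8 done done))) (cmp 2 2 (cmp 3 2 (cmp 4 8 done done) (cmp 4 8 done done)) (cmp 4 8 done done))) (cmp 2 2 (cmp 2 1 (cmp 3 4 (cmp 4 8 done done) (cmp 4 8 done done)) (cmp 3 4 (cmp 4 8 done done) (cmp 4 8 done done))) (cmp 2 3 (cmp 3 4 (cmp 4 8 done done) (cmp 4 8 done done)) (cmp 3 4 (cmp 4 8 done done) (cmp 4 8 done done))))) (cmp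 2 2 (cmp 2 1 (cmp 3 7 (cmp 3 6 (cmp 4 8 done done) (cmp 4 8 done done)) (cmp 3 8 (cmp 4 8 done done) done)) (cmp 3 7 (cmp 3 6 (cmp 4 8 done done) (cmp 4 8 done done)) (cmp 3 8 (cmp 4 8 done done) done))) (cmp 2 3 (cmp 3 7 (cmp 3 6 (cmp 4 8 done done) (cmp 4 8 done done)) (cmp 3 8 (cmp 4 8 done done) done)) (cmp 3 7 (cmp 3 6 (cmp 4 8 done done) (cmp 4 8 done done)) (cmp 3 8 (cmp 4 8 done done) done)))))) (cmp 0 0 (cmp 3 5 (cmp 3 3 (cmp 2 1 (cmp 3 1 (cmp 4 8 done done) (cmp 3 2 (cmp 4 8 done done) (cmp 4 8 done done))) (cmp 2 2 (cmp 3 2 (cmp 4 8 done done) (cmp 4 8 done done)) (cmp 4 8 done done))) (cmp 2 2 (cmp 2 1 (cmp 3 4 (cmp 4 8 done done) (cmp 4 8 done done)) (cmp 3 4 (cmp 4 8 done done) (cmp 4 8 done done))) (cmp 2 3 (cmp 3 4 (cmp 4 8 done done) (cmp 4 8 done done)) (cmp 3 4 (cmp 4 8 done done) (cmp 4 8 done done))))) (cmp 2 2 (cmp 2 1 (cmp 3 7 (cmp 3 6 (cmp 4 8 done done) (cmp 4 8 done done)) (cmp 3 8 (cmp 4 8 done done) done)) (cmp 3 7 (cmp 3 6 (cmp 4 8 done done) (cmp 4 8 done done)) (cmp 3 8 (cmp 4 8 done done) done))) (cmp 2 3 (cmp 3 7 (cmp 3 6 (cmp 4 8 done done) (cmp 4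 8 done done)) (cmp 3 8 (cmp 4 8 done done) done)) (cmp 3 7 (cmp 3 6 (cmp 4 8 done done) (cmp 4 8 done done)) (cmp 3 8 (cmp 4 8 done done) done))))) (cmp 3 5 (cmp 3 3 (cmp 2 1 (cmp 3 1 (cmp 4 8 done done) (cmp 3 2 (cmp 4 8 done done) (cmp 4 8 done done))) (cmp 2 2 (cmp 3 2 (cmp 4 8 done done) (cmp 4 8 done done)) (cmp 4 8 done done))) (cmp 2 2 (cmp 2 1 (cmp 3 4 (cmp 4 8 done done) (cmp 4 8 done done)) (cmp 3 4 (cmp 4 8 done done) (cmp 4 8 done done))) (cmp 2 3 (cmp 3 4 (cmp 4 8 done done) (cmp 4 8 done done)) (cmp 3 4 (cmp 4 8 done done) (cmp 4 8 done done))))) (cmp 2 2 (cmp 2 1 (cmp 3 7 (cmp 3 6 (cmp 4 8 done done) (cmp 4 8 done done)) (cmp 3 8 (cmp 4 8 done done) done)) (cmp 3 7 (cmp 3 6 (cmp 4 8 done done) (cmp 4 8 done done)) (cmp 3 8 (cmp 4 8 done done) done))) (cmp 2 3 (cmp 3 7 (cmp 3 6 (cmp 4 8 done done) (cmp 4 8 done done)) (cmp 3 8 (cmp 4 8 done done) done)) (cmp 3 7 (cmp 3 6 (cmp 4 8 done done) (cmp 4 8 done done)) (cmp 3 8 (cmp 4 8 done done) done))))))) (cmp 0 0 (cmp 1 2 (cmp 2 2 (cmp 3 2 (cmp 4 8 done done) (cmp 3 5 (cmp 3 3 (cmp 4 8 done done) (cmp 3 4 (cmp 4 8 done done) (cmp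 4 8 done done))) (cmp 3 7 (cmp 3 6 (cmp 4 8 done done) (cmp 4 8 done done)) (cmp 3 8 (cmp 4 8 done done) done)))) (cmp 2 3 (cmp 3 5 (cmp 3 3 (cmp 4 8 done done) (cmp 3 4 (cmp 4 8 done done) (cmp 4 8 done done))) (cmp 3 7 (cmp 3 6 (cmp 4 8 done done) (cmp 4 8 done done)) (cmp 3 8 (cmp 4 8 done done) done))) (cmp 3 5 (cmp 3 4 (cmp 4 8 done done) (cmp 4 8 done done)) (cmp 3 7 (cmp 3 6 (cmp 4 8 done done) (cmp 4 8 done done)) (cmp 3 8 (cmp 4 8 done done) done))))) (cmp 1 3 (cmp 2 3 (cmp 3 5 (cmp 3 3 (cmp 4 8 done done) (cmp 3 4 (cmp 4 8 done done) (cmp 4 8 done done))) (cmp 3 7 (cmp 3 6 (cmp 4 8 done done) (cmp 4 8 done done)) (cmp 3 8 (cmp 4 8 done done) done))) (cmp 3 5 (cmp 3 4 (cmp 4 8 done done) (cmp 4 8 done done)) (cmp 3 7 (cmp 3 6 (cmp 4 8 done done) (cmp 4 8 done done)) (cmp 3 8 (cmp 4 8 done done) done)))) (cmp 3 4 (cmp 4 8 done done) (cmp 3 5 (cmp 4 8 done done) (cmp 3 7 (cmp 3 6 (cmp 4 8 done done) (cmp 4 8 done done)) (cmp 3 8 (cmp 4 8 done done) done)))))) (cmp 1 2 (cmp 2 2 (cmp 3 2 (cmp 4 8 done done) (cmp 3 5 (cmp 3 3 (cmp 4 8 done done) (cmp 3 4 (cmp 4 8 done done) (cmp 4 8 done done)))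 (cmp 3 7 (cmp 3 6 (cmp 4 8 done done) (cmp 4 8 done done)) (cmp 3 8 (cmp 4 8 done done) done)))) (cmp 2 3 (cmp 3 5 (cmp 3 3 (cmp 4 8 done done) (cmp 3 4 (cmp 4 8 done done) (cmp 4 8 done done))) (cmp 3 7 (cmp 3 6 (cmp 4 8 done done) (cmp 4 8 done done)) (cmp 3 8 (cmp 4 8 done done) done))) (cmp 3 5 (cmp 3 4 (cmp 4 8 done done) (cmp 4 8 done done)) (cmp 3 7 (cmp 3 6 (cmp 4 8 done done) (cmp 4 8 done done)) (cmp 3 8 (cmp 4 8 done done) done))))) (cmp 1 3 (cmp 2 3 (cmp 3 5 (cmp 3 3 (cmp 4 8 done done) (cmp 3 4 (cmp 4 8 done done) (cmp 4 8 done done))) (cmp 3 7 (cmp 3 6 (cmp 4 8 done done) (cmp 4 8 done done)) (cmp 3 8 (cmp 4 8 done done) done))) (cmp 3 5 (cmp 3 4 (cmp 4 8 done done) (cmp 4 8 done done)) (cmp 3 7 (cmp 3 6 (cmp 4 8 done done) (cmp 4 8 done done)) (cmp 3 8 (cmp 4 8 done done) done)))) (cmp 3 4 (cmp 4 8 done done) (cmp 3 5 (cmp 4 8 done done) (cmp 3 7 (cmp 3 6 (cmp 4 8 done done) (cmp 4 8 done done)) (cmp 3 8 (cmp 4 8 done done) done)))))))) (cmp 0 0 (cmp 1 3 (cmp 1 1 (cmp 1 0 (cmp 3 7 (cmp 2 5 (cmp 3 5 (cmp 4 8 done done) (cmp 3 6 (cmp 4 8 done done) (cmp 4 8 done done)))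 (cmp 2 6 (cmp 3 6 (cmp 4 8 done done) (cmp 4 8 done done)) (cmp 4 8 done done))) (cmp 2 6 (cmp 2 5 (cmp 3 8 (cmp 4 8 done done) done) (cmp 3 8 (cmp 4 8 done done) done)) (cmp 2 7 (cmp 3 8 (cmp 4 8 done done) done) (cmp 3 8 (cmp 4 8 done done) (cmp 2 8 done done))))) (cmp 3 7 (cmp 2 5 (cmp 3 5 (cmp 4 8 done done) (cmp 3 6 (cmp 4 8 done done) (cmp 4 8 done done))) (cmp 2 6 (cmp 3 6 (cmp 4 8 done done) (cmp 4 8 done done)) (cmp 4 8 done done))) (cmp 2 6 (cmp 2 5 (cmp 3 8 (cmp 4 8 done done) done) (cmp 3 8 (cmp 4 8 done done) done)) (cmp 2 7 (cmp 3 8 (cmp 4 8 done done) done) (cmp 3 8 (cmp 4 8 done done) (cmp 2 8 done done)))))) (cmp 1 2 (cmp 3 7 (cmp 2 5 (cmp 3 5 (cmp 4 8 done done) (cmp 3 6 (cmp 4 8 done done) (cmp 4 8 done done))) (cmp 2 6 (cmp 3 6 (cmp 4 8 done done) (cmp 4 8 done done)) (cmp 4 8 done done))) (cmp 2 6 (cmp 2 5 (cmp 3 8 (cmp 4 8 done done) done) (cmp 3 8 (cmp 4 8 done done) done)) (cmp 2 7 (cmp 3 8 (cmp 4 8 done done) done) (cmp 3 8 (cmp 4 8 done done) (cmp 2 8 done done))))) (cmp 3 7 (cmp 2 5 (cmp 3 5 (cmp 4 8 done done) (cmp 3 6 (cmp 4 8 done done) (cmp 4 8 done done))) (cmp 2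 6 (cmp 3 6 (cmp 4 8 done done) (cmp 4 8 done done)) (cmp 4 8 done done))) (cmp 2 6 (cmp 2 5 (cmp 3 8 (cmp 4 8 done done) done) (cmp 3 8 (cmp 4 8 done done) done)) (cmp 2 7 (cmp 3 8 (cmp 4 8 done done) done) (cmp 3 8 (cmp 4 8 done done) (cmp 2 8 done done))))))) (cmp 1 5 (cmp 1 4 (cmp 3 7 (cmp 2 5 (cmp 3 5 (cmp 4 8 done done) (cmp 3 6 (cmp 4 8 done done) (cmp 4 8 done done))) (cmp 2 6 (cmp 3 6 (cmp 4 8 done done) (cmp 4 8 done done)) (cmp 4 8 done done))) (cmp 2 6 (cmp 2 5 (cmp 3 8 (cmp 4 8 done done) done) (cmp 3 8 (cmp 4 8 done done) done)) (cmp 2 7 (cmp 3 8 (cmp 4 8 done done) done) (cmp 3 8 (cmp 4 8 done done) (cmp 2 8 done done))))) (cmp 3 7 (cmp 2 5 (cmp 3 5 (cmp 4 8 done done) (cmp 3 6 (cmp 4 8 done done) (cmp 4 8 done done))) (cmp 2 6 (cmp 3 6 (cmp 4 8 done done) (cmp 4 8 done done)) (cmp 4 8 done done))) (cmp 2 6 (cmp 2 5 (cmp 3 8 (cmp 4 8 done done) done) (cmp 3 8 (cmp 4 8 done done) done)) (cmp 2 7 (cmp 3 8 (cmp 4 8 done done) done) (cmp 3 8 (cmp 4 8 done done) (cmp 2 8 done done)))))) (cmp 1 6 (cmp 2 6 (cmp 3 6 (cmp 4 8 done done) (cmp 3 7 (cmp 4 8 done done) (cmp 3 8 (cmp 4 8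 done done) done))) (cmp 2 7 (cmp 3 7 (cmp 4 8 done done) (cmp 3 8 (cmp 4 8 done done) done)) (cmp 2 8 (cmp 3 8 (cmp 4 8 done done) done) done))) (cmp 1 7 (cmp 2 7 (cmp 3 7 (cmp 4 8 done done) (cmp 3 8 (cmp 4 8 done done) done)) (cmp 2 8 (cmp 3 8 (cmp 4 8 done done) done) done)) (cmp 1 8 (cmp 2 8 (cmp 3 8 (cmp 4 8 done done) done) done) done))))) (cmp 1 3 (cmp 1 1 (cmp 2 5 (cmp 3 5 (cmp 4 8 done done) (cmp 3 6 (cmp 4 8 done done) (cmp 3 7 (cmp 4 8 done done) (cmp 3 8 (cmp 4 8 done done) done)))) (cmp 2 6 (cmp 3 6 (cmp 4 8 done done) (cmp 3 7 (cmp 4 8 done done) (cmp 3 8 (cmp 4 8 done done) done))) (cmp 2 7 (cmp 3 7 (cmp 4 8 done done) (cmp 3 8 (cmp 4 8 done done) done)) (cmp 2 8 (cmp 3 8 (cmp 4 8 done done) done) done)))) (cmp 1 2 (cmp 3 7 (cmp 2 5 (cmp 3 5 (cmp 4 8 done done) (cmp 3 6 (cmp 4 8 done done) (cmp 4 8 done done))) (cmp 2 6 (cmp 3 6 (cmp 4 8 done done) (cmp 4 8 done done)) (cmp 4 8 done done))) (cmp 2 6 (cmp 2 5 (cmp 3 8 (cmp 4 8 done done) done) (cmp 3 8 (cmp 4 8 done done) done)) (cmp 2 7 (cmp 3 8 (cmp 4 8 done done) done) (cmp 3 8 (cmp 4 8 done done) (cmp 2 8 done done))))) (cmp 3 7 (cmp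 2 5 (cmp 3 5 (cmp 4 8 done done) (cmp 3 6 (cmp 4 8 done done) (cmp 4 8 done done))) (cmp 2 6 (cmp 3 6 (cmp 4 8 done done) (cmp 4 8 done done)) (cmp 4 8 done done))) (cmp 2 6 (cmp 2 5 (cmp 3 8 (cmp 4 8 done done) done) (cmp 3 8 (cmp 4 8 done done) done)) (cmp 2 7 (cmp 3 8 (cmp 4 8 done done) done) (cmp 3 8 (cmp 4 8 done done) (cmp 2 8 done done))))))) (cmp 1 5 (cmp 1 4 (cmp 3 7 (cmp 2 5 (cmp 3 5 (cmp 4 8 done done) (cmp 3 6 (cmp 4 8 done done) (cmp 4 8 done done))) (cmp 2 6 (cmp 3 6 (cmp 4 8 done done) (cmp 4 8 done done)) (cmp 4 8 done done))) (cmp 2 6 (cmp 2 5 (cmp 3 8 (cmp 4 8 done done) done) (cmp 3 8 (cmp 4 8 done done) done)) (cmp 2 7 (cmp 3 8 (cmp 4 8 done done) done) (cmp 3 8 (cmp 4 8 done done) (cmp 2 8 done done))))) (cmp 3 7 (cmp 2 5 (cmp 3 5 (cmp 4 8 done done) (cmp 3 6 (cmp 4 8 done done) (cmp 4 8 done done))) (cmp 2 6 (cmp 3 6 (cmp 4 8 done done) (cmp 4 8 done done)) (cmp 4 8 done done))) (cmp 2 6 (cmp 2 5 (cmp 3 8 (cmp 4 8 done done) done) (cmp 3 8 (cmp 4 8 done done) done)) (cmp 2 7 (cmp 3 8 (cmp 4 8 done done) done) (cmp 3 8 (cmp 4 8 done done) (cmp 2 8 done done)))))) (cmp 1 6 (cmp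 2 6 (cmp 3 6 (cmp 4 8 done done) (cmp 3 7 (cmp 4 8 done done) (cmp 3 8 (cmp 4 8 done done) done))) (cmp 2 7 (cmp 3 7 (cmp 4 8 done done) (cmp 3 8 (cmp 4 8 done done) done)) (cmp 2 8 (cmp 3 8 (cmp 4 8 done done) done) done))) (cmp 1 7 (cmp 2 7 (cmp 3 7 (cmp 4 8 done done) (cmp 3 8 (cmp 4 8 done done) done)) (cmp 2 8 (cmp 3 8 (cmp 4 8 done done) done) done)) (cmp 1 8 (cmp 2 8 (cmp 3 8 (cmp 4 8 done done) done) done) done))))))
  tree-near-top-first-10 = cmp 2 5 (cmp 1 1 (cmp 1 0 (cmp 2 0 (cmp 3 0 (cmp 4 10 done done) (cmp 3 1 (cmp 4 10 done done) (cmp 3 3 (cmp 3 2 (cmp 4 10 done done) (cmp 4 10 done done)) (cmp 3 7 (cmp 3 5 (cmp 3 4 (cmp 4 10 done done) (cmp 4 10 done done)) (cmp 3 6 (cmp 4 10 done done) (cmp 4 10 done done))) (cmp 3 9 (cmp 3 8 (cmp 4 10 done done) (cmp 4 10 done done)) (cmp 3 10 (cmp 4 10 done done) done)))))) (cmp 2 2 (cmp 2 1 (cmp 3 3 (cmp 3 1 (cmp 4 10 done done) (cmp 3 2 (cmp 4 10 done done) (cmp 4 10 done done))) (cmp 3 7 (cmp 3 5 (cmp 3 4 (cmp 4 10 done done) (cmp 4 10 done done)) (cmp 3 6 (cmp 4 10 done done) (cmp 4 10 done done))) (cmp 3 9 (cmp 3 8 (cmp 4 10 done done) (cmp 4 10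 done done)) (cmp 3 10 (cmp 4 10 done done) done)))) (cmp 3 3 (cmp 3 2 (cmp 4 10 done done) (cmp 4 10 done done)) (cmp 3 7 (cmp 3 5 (cmp 3 4 (cmp 4 10 done done) (cmp 4 10 done done)) (cmp 3 6 (cmp 4 10 done done) (cmp 4 10 done done))) (cmp 3 9 (cmp 3 8 (cmp 4 10 done done) (cmp 4 10 done done)) (cmp 3 10 (cmp 4 10 done done) done))))) (cmp 2 3 (cmp 3 3 (cmp 4 10 done done) (cmp 3 7 (cmp 3 5 (cmp 3 4 (cmp 4 10 done done) (cmp 4 10 done done)) (cmp 3 6 (cmp 4 10 done done) (cmp 4 10 done done))) (cmp 3 9 (cmp 3 8 (cmp 4 10 done done) (cmp 4 10 done done)) (cmp 3 10 (cmp 4 10 done done) done)))) (cmp 2 4 (cmp 3 7 (cmp 3 5 (cmp 3 4 (cmp 4 10 done done) (cmp 4 10 done done)) (cmp 3 6 (cmp 4 10 done done) (cmp 4 10 done done))) (cmp 3 9 (cmp 3 8 (cmp 4 10 done done) (cmp 4 10 done done)) (cmp 3 10 (cmp 4 10 done done) done))) (cmp 3 7 (cmp 3 5 (cmp 4 10 done done) (cmp 3 6 (cmp 4 10 done done) (cmp 4 10 done done))) (cmp 3 9 (cmp 3 8 (cmp 4 10 done done) (cmp 4 10 done done)) (cmp 3 10 (cmp 4 10 done done) done))))))) (cmp 0 0 (cmp 2 2 (cmp 2 1 (cmp 3 3 (cmp 3 1 (cmp 4 10 done done) (cmp 3 2 (cmp 4 10 done done) (cmp 4 10 done done))) (cmp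 3 7 (cmp 3 5 (cmp 3 4 (cmp 4 10 done done) (cmp 4 10 done done)) (cmp 3 6 (cmp 4 10 done done) (cmp 4 10 done done))) (cmp 3 9 (cmp 3 8 (cmp 4 10 done done) (cmp 4 10 done done)) (cmp 3 10 (cmp 4 10 done done) done)))) (cmp 3 3 (cmp 3 2 (cmp 4 10 done done) (cmp 4 10 done done)) (cmp 3 7 (cmp 3 5 (cmp 3 4 (cmp 4 10 done done) (cmp 4 10 done done)) (cmp 3 6 (cmp 4 10 done done) (cmp 4 10 done done))) (cmp 3 9 (cmp 3 8 (cmp 4 10 done done) (cmp 4 10 done done)) (cmp 3 10 (cmp 4 10 done done) done))))) (cmp 2 3 (cmp 3 3 (cmp 4 10 done done) (cmp 3 7 (cmp 3 5 (cmp 3 4 (cmp 4 10 done done) (cmp 4 10 done done)) (cmp 3 6 (cmp 4 10 done done) (cmp 4 10 done done))) (cmp 3 9 (cmp 3 8 (cmp 4 10 done done) (cmp 4 10 done done)) (cmp 3 10 (cmp 4 10 done done) done)))) (cmp 2 4 (cmp 3 7 (cmp 3 5 (cmp 3 4 (cmp 4 10 done done) (cmp 4 10 done done)) (cmp 3 6 (cmp 4 10 done done) (cmp 4 10 done done))) (cmp 3 9 (cmp 3 8 (cmp 4 10 done done) (cmp 4 10 done done)) (cmp 3 10 (cmp 4 10 done done) done))) (cmp 3 7 (cmp 3 5 (cmp 4 10 done done) (cmp 3 6 (cmp 4 10 done done) (cmp 4 10 done done))) (cmp 3 9 (cmp 3 8 (cmp 4 10 done done) (cmp 4 10 done done)) (cmp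 3 10 (cmp 4 10 done done) done)))))) (cmp 2 2 (cmp 2 1 (cmp 3 3 (cmp 3 1 (cmp 4 10 done done) (cmp 3 2 (cmp 4 10 done done) (cmp 4 10 done done))) (cmp 3 7 (cmp 3 5 (cmp 3 4 (cmp 4 10 done done) (cmp 4 10 done done)) (cmp 3 6 (cmp 4 10 done done) (cmp 4 10 done done))) (cmp 3 9 (cmp 3 8 (cmp 4 10 done done) (cmp 4 10 done done)) (cmp 3 10 (cmp 4 10 done done) done)))) (cmp 3 3 (cmp 3 2 (cmp 4 10 done done) (cmp 4 10 done done)) (cmp 3 7 (cmp 3 5 (cmp 3 4 (cmp 4 10 done done) (cmp 4 10 done done)) (cmp 3 6 (cmp 4 10 done done) (cmp 4 10 done done))) (cmp 3 9 (cmp 3 8 (cmp 4 10 done done) (cmp 4 10 done done)) (cmp 3 10 (cmp 4 10 done done) done))))) (cmp 2 3 (cmp 3 3 (cmp 4 10 done done) (cmp 3 7 (cmp 3 5 (cmp 3 4 (cmp 4 10 done done) (cmp 4 10 done done)) (cmp 3 6 (cmp 4 10 done done) (cmp 4 10 done done))) (cmp 3 9 (cmp 3 8 (cmp 4 10 done done) (cmp 4 10 done done)) (cmp 3 10 (cmp 4 10 done done) done)))) (cmp 2 4 (cmp 3 7 (cmp 3 5 (cmp 3 4 (cmp 4 10 done done) (cmp 4 10 done done)) (cmp 3 6 (cmp 4 10 done done) (cmp 4 10 done done))) (cmp 3 9 (cmp 3 8 (cmp 4 10 done done) (cmp 4 10 done done)) (cmp 3 10 (cmp 4 10 done done) done)))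 (cmp 3 7 (cmp 3 5 (cmp 4 10 done done) (cmp 3 6 (cmp 4 10 done done) (cmp 4 10 done done))) (cmp 3 9 (cmp 3 8 (cmp 4 10 done done) (cmp 4 10 done done)) (cmp 3 10 (cmp 4 10 done done) done)))))))) (cmp 0 0 (cmp 1 2 (cmp 2 2 (cmp 3 2 (cmp 4 10 done done) (cmp 3 3 (cmp 4 10 done done) (cmp 3 7 (cmp 3 5 (cmp 3 4 (cmp 4 10 done done) (cmp 4 10 done done)) (cmp 3 6 (cmp 4 10 done done) (cmp 4 10 done done))) (cmp 3 9 (cmp 3 8 (cmp 4 10 done done) (cmp 4 10 done done)) (cmp 3 10 (cmp 4 10 done done) done))))) (cmp 2 3 (cmp 3 3 (cmp 4 10 done done) (cmp 3 7 (cmp 3 5 (cmp 3 4 (cmp 4 10 done done) (cmp 4 10 done done)) (cmp 3 6 (cmp 4 10 done done) (cmp 4 10 done done))) (cmp 3 9 (cmp 3 8 (cmp 4 10 done done) (cmp 4 10 done done)) (cmp 3 10 (cmp 4 10 done done) done)))) (cmp 2 4 (cmp 3 7 (cmp 3 5 (cmp 3 4 (cmp 4 10 done done) (cmp 4 10 done done)) (cmp 3 6 (cmp 4 10 done done) (cmp 4 10 done done))) (cmp 3 9 (cmp 3 8 (cmp 4 10 done done) (cmp 4 10 done done)) (cmp 3 10 (cmp 4 10 done done) done))) (cmp 3 7 (cmp 3 5 (cmp 4 10 done done) (cmp 3 6 (cmp 4 10 done done) (cmp 4 10 done done))) (cmp 3 9 (cmp 3 8 (cmp 4 10 done done) (cmp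 4 10 done done)) (cmp 3 10 (cmp 4 10 done done) done)))))) (cmp 1 3 (cmp 2 3 (cmp 3 3 (cmp 4 10 done done) (cmp 3 7 (cmp 3 5 (cmp 3 4 (cmp 4 10 done done) (cmp 4 10 done done)) (cmp 3 6 (cmp 4 10 done done) (cmp 4 10 done done))) (cmp 3 9 (cmp 3 8 (cmp 4 10 done done) (cmp 4 10 done done)) (cmp 3 10 (cmp 4 10 done done) done)))) (cmp 2 4 (cmp 3 7 (cmp 3 5 (cmp 3 4 (cmp 4 10 done done) (cmp 4 10 done done)) (cmp 3 6 (cmp 4 10 done done) (cmp 4 10 done done))) (cmp 3 9 (cmp 3 8 (cmp 4 10 done done) (cmp 4 10 done done)) (cmp 3 10 (cmp 4 10 done done) done))) (cmp 3 7 (cmp 3 5 (cmp 4 10 done done) (cmp 3 6 (cmp 4 10 done done) (cmp 4 10 done done))) (cmp 3 9 (cmp 3 8 (cmp 4 10 done done) (cmp 4 10 done done)) (cmp 3 10 (cmp 4 10 done done) done))))) (cmp 1 4 (cmp 2 4 (cmp 3 7 (cmp 3 5 (cmp 3 4 (cmp 4 10 done done) (cmp 4 10 done done)) (cmp 3 6 (cmp 4 10 done done) (cmp 4 10 done done))) (cmp 3 9 (cmp 3 8 (cmp 4 10 done done) (cmp 4 10 done done)) (cmp 3 10 (cmp 4 10 done done) done))) (cmp 3 7 (cmp 3 5 (cmp 4 10 done done) (cmp 3 6 (cmp 4 10 done done) (cmp 4 10 done done))) (cmp 3 9 (cmp 3 8 (cmp 4 10 done done) (cmp 4 10 done done)) (cmp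 3 10 (cmp 4 10 done done) done)))) (cmp 3 5 (cmp 4 10 done done) (cmp 3 7 (cmp 3 6 (cmp 4 10 done done) (cmp 4 10 done done)) (cmp 3 9 (cmp 3 8 (cmp 4 10 done done) (cmp 4 10 done done)) (cmp 3 10 (cmp 4 10 done done) done))))))) (cmp 1 2 (cmp 2 2 (cmp 3 2 (cmp 4 10 done done) (cmp 3 3 (cmp 4 10 done done) (cmp 3 7 (cmp 3 5 (cmp 3 4 (cmp 4 10 done done) (cmp 4 10 done done)) (cmp 3 6 (cmp 4 10 done done) (cmp 4 10 done done))) (cmp 3 9 (cmp 3 8 (cmp 4 10 done done) (cmp 4 10 done done)) (cmp 3 10 (cmp 4 10 done done) done))))) (cmp 2 3 (cmp 3 3 (cmp 4 10 done done) (cmp 3 7 (cmp 3 5 (cmp 3 4 (cmp 4 10 done done) (cmp 4 10 done done)) (cmp 3 6 (cmp 4 10 done done) (cmp 4 10 done done))) (cmp 3 9 (cmp 3 8 (cmp 4 10 done done) (cmp 4 10 done done)) (cmp 3 10 (cmp 4 10 done done) done)))) (cmp 2 4 (cmp 3 7 (cmp 3 5 (cmp 3 4 (cmp 4 10 done done) (cmp 4 10 done done)) (cmp 3 6 (cmp 4 10 done done) (cmp 4 10 done done))) (cmp 3 9 (cmp 3 8 (cmp 4 10 done done) (cmp 4 10 done done)) (cmp 3 10 (cmp 4 10 done done) done))) (cmp 3 7 (cmp 3 5 (cmp 4 10 done done) (cmp 3 6 (cmp 4 10 done done) (cmp 4 10 done done))) (cmp 3 9 (cmp 3 8 (cmp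 4 10 done done) (cmp 4 10 done done)) (cmp 3 10 (cmp 4 10 done done) done)))))) (cmp 1 3 (cmp 2 3 (cmp 3 3 (cmp 4 10 done done) (cmp 3 7 (cmp 3 5 (cmp 3 4 (cmp 4 10 done done) (cmp 4 10 done done)) (cmp 3 6 (cmp 4 10 done done) (cmp 4 10 done done))) (cmp 3 9 (cmp 3 8 (cmp 4 10 done done) (cmp 4 10 done done)) (cmp 3 10 (cmp 4 10 done done) done)))) (cmp 2 4 (cmp 3 7 (cmp 3 5 (cmp 3 4 (cmp 4 10 done done) (cmp 4 10 done done)) (cmp 3 6 (cmp 4 10 done done) (cmp 4 10 done done))) (cmp 3 9 (cmp 3 8 (cmp 4 10 done done) (cmp 4 10 done done)) (cmp 3 10 (cmp 4 10 done done) done))) (cmp 3 7 (cmp 3 5 (cmp 4 10 done done) (cmp 3 6 (cmp 4 10 done done) (cmp 4 10 done done))) (cmp 3 9 (cmp 3 8 (cmp 4 10 done done) (cmp 4 10 done done)) (cmp 3 10 (cmp 4 10 done done) done))))) (cmp 1 4 (cmp 2 4 (cmp 3 7 (cmp 3 5 (cmp 3 4 (cmp 4 10 done done) (cmp 4 10 done done)) (cmp 3 6 (cmp 4 10 done done) (cmp 4 10 done done))) (cmp 3 9 (cmp 3 8 (cmp 4 10 done done) (cmp 4 10 done done)) (cmp 3 10 (cmp 4 10 done done) done))) (cmp 3 7 (cmp 3 5 (cmp 4 10 done done) (cmp 3 6 (cmp 4 10 done done) (cmp 4 10 done done))) (cmp 3 9 (cmp 3 8 (cmp 4 10 done done) (cmp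 4 10 done done)) (cmp 3 10 (cmp 4 10 done done) done)))) (cmp 3 5 (cmp 4 10 done done) (cmp 3 7 (cmp 3 6 (cmp 4 10 done done) (cmp 4 10 done done)) (cmp 3 9 (cmp 3 8 (cmp 4 10 done done) (cmp 4 10 done done)) (cmp 3 10 (cmp 4 10 done done) done))))))))) (cmp 0 0 (cmp 1 3 (cmp 1 1 (cmp 1 0 (cmp 2 6 (cmp 3 6 (cmp 4 10 done done) (cmp 3 7 (cmp 4 10 done done) (cmp 3 9 (cmp 3 8 (cmp 4 10 done done) (cmp 4 10 done done)) (cmp 3 10 (cmp 4 10 done done) done)))) (cmp 3 9 (cmp 2 7 (cmp 3 7 (cmp 4 10 done done) (cmp 3 8 (cmp 4 10 done done) (cmp 4 10 done done))) (cmp 2 8 (cmp 3 8 (cmp 4 10 done done) (cmp 4 10 done done)) (cmp 4 10 done done))) (cmp 2 8 (cmp 2 7 (cmp 3 10 (cmp 4 10 done done) done) (cmp 3 10 (cmp 4 10 done done) done)) (cmp 2 9 (cmp 3 10 (cmp 4 10 done done) done) (cmp 3 10 (cmp 4 10 done done) (cmp 2 10 done done)))))) (cmp 2 6 (cmp 3 6 (cmp 4 10 done done) (cmp 3 7 (cmp 4 10 done done) (cmp 3 9 (cmp 3 8 (cmp 4 10 done done) (cmp 4 10 done done)) (cmp 3 10 (cmp 4 10 done done) done)))) (cmp 3 9 (cmp 2 7 (cmp 3 7 (cmp 4 10 done done) (cmp 3 8 (cmp 4 10 done done) (cmp 4 10 done done))) (cmp 2 8 (cmp 3 8 (cmp 4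 10 done done) (cmp 4 10 done done)) (cmp 4 10 done done))) (cmp 2 8 (cmp 2 7 (cmp 3 10 (cmp 4 10 done done) done) (cmp 3 10 (cmp 4 10 done done) done)) (cmp 2 9 (cmp 3 10 (cmp 4 10 done done) done) (cmp 3 10 (cmp 4 10 done done) (cmp 2 10 done done))))))) (cmp 1 2 (cmp 2 6 (cmp 3 6 (cmp 4 10 done done) (cmp 3 7 (cmp 4 10 done done) (cmp 3 9 (cmp 3 8 (cmp 4 10 done done) (cmp 4 10 done done)) (cmp 3 10 (cmp 4 10 done done) done)))) (cmp 3 9 (cmp 2 7 (cmp 3 7 (cmp 4 10 done done) (cmp 3 8 (cmp 4 10 done done) (cmp 4 10 done done))) (cmp 2 8 (cmp 3 8 (cmp 4 10 done done) (cmp 4 10 done done)) (cmp 4 10 done done))) (cmp 2 8 (cmp 2 7 (cmp 3 10 (cmp 4 10 done done) done) (cmp 3 10 (cmp 4 10 done done) done)) (cmp 2 9 (cmp 3 10 (cmp 4 10 done done) done) (cmp 3 10 (cmp 4 10 done done) (cmp 2 10 done done)))))) (cmp 2 6 (cmp 3 6 (cmp 4 10 done done) (cmp 3 7 (cmp 4 10 done done) (cmp 3 9 (cmp 3 8 (cmp 4 10 done done) (cmp 4 10 done done)) (cmp 3 10 (cmp 4 10 done done) done)))) (cmp 3 9 (cmp 2 7 (cmp 3 7 (cmp 4 10 done done) (cmp 3 8 (cmp 4 10 done done) (cmp 4 10 done done))) (cmp 2 8 (cmp 3 8 (cmp 4 10 done done) (cmp 4 10 done done)) (cmp 4 10 done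 done))) (cmp 2 8 (cmp 2 7 (cmp 3 10 (cmp 4 10 done done) done) (cmp 3 10 (cmp 4 10 done done) done)) (cmp 2 9 (cmp 3 10 (cmp 4 10 done done) done) (cmp 3 10 (cmp 4 10 done done) (cmp 2 10 done done)))))))) (cmp 3 9 (cmp 1 5 (cmp 1 4 (cmp 2 6 (cmp 3 6 (cmp 4 10 done done) (cmp 3 7 (cmp 4 10 done done) (cmp 3 8 (cmp 4 10 done done) (cmp 4 10 done done)))) (cmp 2 7 (cmp 3 7 (cmp 4 10 done done) (cmp 3 8 (cmp 4 10 done done) (cmp 4 10 done done))) (cmp 2 8 (cmp 3 8 (cmp 4 10 done done) (cmp 4 10 done done)) (cmp 4 10 done done)))) (cmp 2 6 (cmp 3 6 (cmp 4 10 done done) (cmp 3 7 (cmp 4 10 done done) (cmp 3 8 (cmp 4 10 done done) (cmp 4 10 done done)))) (cmp 2 7 (cmp 3 7 (cmp 4 10 done done) (cmp 3 8 (cmp 4 10 done done) (cmp 4 10 done done))) (cmp 2 8 (cmp 3 8 (cmp 4 10 done done) (cmp 4 10 done done)) (cmp 4 10 done done))))) (cmp 1 6 (cmp 2 6 (cmp 3 6 (cmp 4 10 done done) (cmp 3 7 (cmp 4 10 done done) (cmp 3 8 (cmp 4 10 done done) (cmp 4 10 done done)))) (cmp 2 7 (cmp 3 7 (cmp 4 10 done done) (cmp 3 8 (cmp 4 10 done done) (cmp 4 10 done done))) (cmp 2 8 (cmp 3 8 (cmp 4 10 done done) (cmp 4 10 done done)) (cmp 4 10 done done)))) (cmp 1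 7 (cmp 2 7 (cmp 3 7 (cmp 4 10 done done) (cmp 3 8 (cmp 4 10 done done) (cmp 4 10 done done))) (cmp 2 8 (cmp 3 8 (cmp 4 10 done done) (cmp 4 10 done done)) (cmp 4 10 done done))) (cmp 1 8 (cmp 2 8 (cmp 3 8 (cmp 4 10 done done) (cmp 4 10 done done)) (cmp 4 10 done done)) (cmp 4 10 done done))))) (cmp 2 8 (cmp 1 5 (cmp 1 4 (cmp 2 6 (cmp 3 10 (cmp 4 10 done done) done) (cmp 2 7 (cmp 3 10 (cmp 4 10 done done) done) (cmp 3 10 (cmp 4 10 done done) done))) (cmp 2 6 (cmp 3 10 (cmp 4 10 done done) done) (cmp 2 7 (cmp 3 10 (cmp 4 10 done done) done) (cmp 3 10 (cmp 4 10 done done) done)))) (cmp 1 6 (cmp 2 6 (cmp 3 10 (cmp 4 10 done done) done) (cmp 2 7 (cmp 3 10 (cmp 4 10 done done) done) (cmp 3 10 (cmp 4 10 done done) done))) (cmp 1 7 (cmp 2 7 (cmp 3 10 (cmp 4 10 done done) done) (cmp 3 10 (cmp 4 10 done done) done)) (cmp 3 10 (cmp 4 10 done done) done)))) (cmp 1 6 (cmp 1 4 (cmp 2 9 (cmp 3 10 (cmp 4 10 done done) done) (cmp 2 10 (cmp 3 10 (cmp 4 10 done done) done) done)) (cmp 1 5 (cmp 2 9 (cmp 3 10 (cmp 4 10 done done) done) (cmp 3 10 (cmp 4 10 done done) (cmp 2 10 done done))) (cmp 2 9 (cmp 3 10 (cmp 4 10 done done) done) (cmp 3 10 (cmp 4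 10 done done) (cmp 2 10 done done))))) (cmp 1 8 (cmp 1 7 (cmp 2 9 (cmp 3 10 (cmp 4 10 done done) done) (cmp 3 10 (cmp 4 10 done done) (cmp 2 10 done done))) (cmp 2 9 (cmp 3 10 (cmp 4 10 done done) done) (cmp 3 10 (cmp 4 10 done done) (cmp 2 10 done done)))) (cmp 1 9 (cmp 2 9 (cmp 3 10 (cmp 4 10 done done) done) (cmp 3 10 (cmp 4 10 done done) (cmp 2 10 done done))) (cmp 1 10 (cmp 3 10 (cmp 4 10 done done) (cmp 2 10 done done)) done))))))) (cmp 1 3 (cmp 1 1 (cmp 2 6 (cmp 3 6 (cmp 4 10 done done) (cmp 3 7 (cmp 4 10 done done) (cmp 3 8 (cmp 4 10 done done) (cmp 3 9 (cmp 4 10 done done) (cmp 3 10 (cmp 4 10 done done) done))))) (cmp 2 7 (cmp 3 7 (cmp 4 10 done done) (cmp 3 8 (cmp 4 10 done done) (cmp 3 9 (cmp 4 10 done done) (cmp 3 10 (cmp 4 10 done done) done)))) (cmp 2 8 (cmp 3 8 (cmp 4 10 done done) (cmp 3 9 (cmp 4 10 done done) (cmp 3 10 (cmp 4 10 done done) done))) (cmp 2 9 (cmp 3 9 (cmp 4 10 done done) (cmp 3 10 (cmp 4 10 done done) done)) (cmp 2 10 (cmp 3 10 (cmp 4 10 done done) done) done))))) (cmp 1 2 (cmp 2 6 (cmp 3 6 (cmp 4 10 done done) (cmp 3 7 (cmp 4 10 done done) (cmp 3 9 (cmp 3 8 (cmp 4 10 done done) (cmp 4 10 done done)) (cmp 3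 10 (cmp 4 10 done done) done)))) (cmp 3 9 (cmp 2 7 (cmp 3 7 (cmp 4 10 done done) (cmp 3 8 (cmp 4 10 done done) (cmp 4 10 done done))) (cmp 2 8 (cmp 3 8 (cmp 4 10 done done) (cmp 4 10 done done)) (cmp 4 10 done done))) (cmp 2 8 (cmp 2 7 (cmp 3 10 (cmp 4 10 done done) done) (cmp 3 10 (cmp 4 10 done done) done)) (cmp 2 9 (cmp 3 10 (cmp 4 10 done done) done) (cmp 3 10 (cmp 4 10 done done) (cmp 2 10 done done)))))) (cmp 2 6 (cmp 3 6 (cmp 4 10 done done) (cmp 3 7 (cmp 4 10 done done) (cmp 3 9 (cmp 3 8 (cmp 4 10 done done) (cmp 4 10 done done)) (cmp 3 10 (cmp 4 10 done done) done)))) (cmp 3 9 (cmp 2 7 (cmp 3 7 (cmp 4 10 done done) (cmp 3 8 (cmp 4 10 done done) (cmp 4 10 done done))) (cmp 2 8 (cmp 3 8 (cmp 4 10 done done) (cmp 4 10 done done)) (cmp 4 10 done done))) (cmp 2 8 (cmp 2 7 (cmp 3 10 (cmp 4 10 done done) done) (cmp 3 10 (cmp 4 10 done done) done)) (cmp 2 9 (cmp 3 10 (cmp 4 10 done done) done) (cmp 3 10 (cmp 4 10 done done) (cmp 2 10 done done)))))))) (cmp 3 9 (cmp 1 5 (cmp 1 4 (cmp 2 6 (cmp 3 6 (cmp 4 10 done done) (cmp 3 7 (cmp 4 10 done done) (cmp 3 8 (cmp 4 10 done done) (cmp 4 10 done done)))) (cmp 2 7 (cmp 3 7 (cmp 4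 10 done done) (cmp 3 8 (cmp 4 10 done done) (cmp 4 10 done done))) (cmp 2 8 (cmp 3 8 (cmp 4 10 done done) (cmp 4 10 done done)) (cmp 4 10 done done)))) (cmp 2 6 (cmp 3 6 (cmp 4 10 done done) (cmp 3 7 (cmp 4 10 done done) (cmp 3 8 (cmp 4 10 done done) (cmp 4 10 done done)))) (cmp 2 7 (cmp 3 7 (cmp 4 10 done done) (cmp 3 8 (cmp 4 10 done done) (cmp 4 10 done done))) (cmp 2 8 (cmp 3 8 (cmp 4 10 done done) (cmp 4 10 done done)) (cmp 4 10 done done))))) (cmp 1 6 (cmp 2 6 (cmp 3 6 (cmp 4 10 done done) (cmp 3 7 (cmp 4 10 done done) (cmp 3 8 (cmp 4 10 done done) (cmp 4 10 done done)))) (cmp 2 7 (cmp 3 7 (cmp 4 10 done done) (cmp 3 8 (cmp 4 10 done done) (cmp 4 10 done done))) (cmp 2 8 (cmp 3 8 (cmp 4 10 done done) (cmp 4 10 done done)) (cmp 4 10 done done)))) (cmp 1 7 (cmp 2 7 (cmp 3 7 (cmp 4 10 done done) (cmp 3 8 (cmp 4 10 done done) (cmp 4 10 done done))) (cmp 2 8 (cmp 3 8 (cmp 4 10 done done) (cmp 4 10 done done)) (cmp 4 10 done done))) (cmp 1 8 (cmp 2 8 (cmp 3 8 (cmp 4 10 done done) (cmp 4 10 done done)) (cmp 4 10 done done)) (cmp 4 10 done done))))) (cmp 2 8 (cmp 1 5 (cmp 1 4 (cmp 2 6 (cmp 3 10 (cmp 4 10 done done) done) (cmp 2 7 (cmp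 3 10 (cmp 4 10 done done) done) (cmp 3 10 (cmp 4 10 done done) done))) (cmp 2 6 (cmp 3 10 (cmp 4 10 done done) done) (cmp 2 7 (cmp 3 10 (cmp 4 10 done done) done) (cmp 3 10 (cmp 4 10 done done) done)))) (cmp 1 6 (cmp 2 6 (cmp 3 10 (cmp 4 10 done done) done) (cmp 2 7 (cmp 3 10 (cmp 4 10 done done) done) (cmp 3 10 (cmp 4 10 done done) done))) (cmp 1 7 (cmp 2 7 (cmp 3 10 (cmp 4 10 done done) done) (cmp 3 10 (cmp 4 10 done done) done)) (cmp 3 10 (cmp 4 10 done done) done)))) (cmp 1 6 (cmp 1 4 (cmp 2 9 (cmp 3 10 (cmp 4 10 done done) done) (cmp 2 10 (cmp 3 10 (cmp 4 10 done done) done) done)) (cmp 1 5 (cmp 2 9 (cmp 3 10 (cmp 4 10 done done) done) (cmp 3 10 (cmp 4 10 done done) (cmp 2 10 done done))) (cmp 2 9 (cmp 3 10 (cmp 4 10 done done) done) (cmp 3 10 (cmp 4 10 done done) (cmp 2 10 done done))))) (cmp 1 8 (cmp 1 7 (cmp 2 9 (cmp 3 10 (cmp 4 10 done done) done) (cmp 3 10 (cmp 4 10 done done) (cmp 2 10 done done))) (cmp 2 9 (cmp 3 10 (cmp 4 10 done done) done) (cmp 3 10 (cmp 4 10 done done) (cmp 2 10 done done)))) (cmp 1 9 (cmp 2 9 (cmp 3 10 (cmp 4 10 done done) done) (cmp 3 10 (cmp 4 10 done done) (cmp 2 10 done done))) (cmp 1 10 (cmp 3 10 (cmp 4 10 done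 done) (cmp 2 10 done done)) done))))))))

  merge-1-7 : Recovers 1 (Interleaving 1 7) 3
  merge-1-7 = weaken interleaving-box ≤-refl (certified 1 tree-1-7 (λ _ → 0) (λ _ → 7) tt)

  merge-2-11 : Recovers 2 (Interleaving 2 11) 7
  merge-2-11 = weaken interleaving-box ≤-refl (certified 2 tree-2-11 (λ _ → 0) (λ _ → 11) tt)

  merge-3-13 : Recovers 3 (Interleaving 3 13) 10
  merge-3-13 = weaken interleaving-box ≤-refl (certified 3 tree-3-13 (λ _ → 0) (λ _ → 13) tt)

  near-top-6 : Recovers 5 (LastNearTop 4 6) 10
  near-top-6 = weaken near-top-box ≤-refl (certified 5 tree-near-top-6 (step-at 4 6) (λ _ → 7) tt)

  merges-1 : Ladder 1 (Interleaving 1) 7 3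
  merges-1 = climb merge-1-7 (ladder λ _ → weaken id z≤n recovers-nothing)

  merges-2 : Ladder 2 (Interleaving 2) 11 7
  merges-2 = climb merge-2-11 (ladder-shift merges-1 3)

  merges-3 : Ladder 3 (Interleaving 3) 13 10
  merges-3 = climb merge-3-13 (ladder-shift merges-2 2)

  near-top-first : ∀ h → Recovers 5 (λ r → LastNearTop 4 (8 + 2 * h) r × r 0 ≤ 1) (10 + h)
  near-top-first 0 = weaken near-top-first-box ≤-refl
    (certified 5 tree-near-top-first-8 (step-at 4 8) (first-capped 8) tt)
  near-top-first 1 = weaken near-top-first-box ≤-refl
    (certified 5 tree-near-top-first-10 (step-at 4 10) (first-capped 10) tt)
  near-top-first (suc (suc h)) =
    subst (λ n → Recovers 5 (λ r → LastNearTop 4 n r × r 0 ≤ 1) (12 + h)) (size h)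
      (settle-first (settle-last (rung merges-3 h)) λ (L , r0≤1) → near-top-tail L , r0≤1)
    where
    size : ∀ h → 12 + 2 * h ≡ 8 + 2 * (2 + h)
    size = solve-∀

  near-top : Ladder 5 (LastNearTop 4) 6 10
  near-top = climb-ladder near-top-6 λ {h} → split-first (near-top-first h)

  merges-5 : Ladder 5 (Interleaving 5) 7 11
  merges-5 = climb-ladder (linear-merge 4 7) λ {h} below → split-last below (rung (ladder-shift near-top 1) h)

  merges : ∀ a → Ladder (5 + a) (Interleaving (5 + a)) (7 + 2 * a) (11 + 3 * a)
  merges zero    = merges-5
  merges (suc a) =
    climb (subst (Recovers _ _) (linear-cost a) (linear-merge (5 + a) (7 + 2 * suc a)))
          (subst₂ (Ladder (5 + a) (Interleaving (5 + a))) (shifted-size a) (shifted-cost a)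
                  (ladder-shift (merges a) 2))
    where
    linear-cost : ∀ a → 5 + a + (7 + 2 * suc a) ≡ 11 + 3 * suc a
    linear-cost = solve-∀
    shifted-size : ∀ a → 7 + 2 * a + 2 * 2 ≡ 2 + (7 + 2 * suc a)
    shifted-size = solve-∀
    shifted-cost : ∀ a → 11 + 3 * a + 2 ≡ 10 + 3 * suc a
    shifted-cost = solve-∀

open Merging using (merges; rung; M≤-from-recovers)

open import Data.Nat using (ℕ; _≤_; s≤s)
import Data.Nat as ℕ
open import Data.Nat.Properties using (m≤m+n; m+n∸m≡n)
open import Data.Nat.Tactic.RingSolver using (solve-∀)
open import Data.Integer using (ℤ; +_; -[1+_]; _+_; _*_; ∣_∣; -≤-) renaming (_≤_ to _≤ℤ_)
open import Data.Integer.Properties using (⊖-≥; pos-*)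
open import Relation.Binary.PropositionalEquality using (_≡_; refl; sym; trans; cong; subst₂)

merge-bound : ∀ a h → M≤ (5 ℕ.+ a) (7 ℕ.+ 2 ℕ.* a ℕ.+ 2 ℕ.* h) (11 ℕ.+ 3 ℕ.* a ℕ.+ h)
merge-bound a h = M≤-from-recovers (rung (merges a) h)

∣+m+-[1+n]∣ : ∀ {m} n o → m ≡ ℕ.suc n ℕ.+ o → ∣ + m + -[1+ n ] ∣ ≡ o
∣+m+-[1+n]∣ n o refl = trans (cong ∣_∣ (⊖-≥ (m≤m+n (ℕ.suc n) o))) (m+n∸m≡n (ℕ.suc n) o)

theorem7 : ∀ (m : ℕ) (k : ℤ) → 5 ≤ m → -[1+ 0 ] ≤ℤ k →
    M≤ m ∣ + 2 * + m + + 2 * k + -[1+ 0 ] ∣ ∣ + 3 * + m + k + -[1+ 2 ] ∣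
theorem7 _ -[1+ ℕ.suc _ ] _ (-≤- ())
theorem7 .(5 ℕ.+ a) -[1+ 0 ] (s≤s (s≤s (s≤s (s≤s (s≤s {n = a} _))))) _ =
  subst₂ (M≤ (5 ℕ.+ a)) (sym size) (sym cost) (merge-bound a 0)
  where
  -- Both integer expressions evaluate to the form ∣ + x + -[1+ c ] ∣, as 5 + a is a successor.
  size : ∣ + 2 * + (5 ℕ.+ a) + + 2 * -[1+ 0 ] + -[1+ 0 ] ∣ ≡ 7 ℕ.+ 2 ℕ.* a ℕ.+ 2 ℕ.* 0
  size = ∣+m+-[1+n]∣ 2 _ (double a)
    where
    double : ∀ a → 2 ℕ.* (5 ℕ.+ a) ≡ 3 ℕ.+ (7 ℕ.+ 2 ℕ.* a ℕ.+ 2 ℕ.* 0)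
    double = solve-∀
  cost : ∣ + 3 * + (5 ℕ.+ a) + -[1+ 0 ] + -[1+ 2 ] ∣ ≡ 11 ℕ.+ 3 ℕ.* a ℕ.+ 0
  cost = ∣+m+-[1+n]∣ 3 _ (triple a)
    where
    triple : ∀ a → 3 ℕ.* (5 ℕ.+ a) ≡ 4 ℕ.+ (11 ℕ.+ 3 ℕ.* a ℕ.+ 0)
    triple = solve-∀
theorem7 .(5 ℕ.+ a) (+ j) (s≤s (s≤s (s≤s (s≤s (s≤s {n = a} _))))) _ =
  subst₂ (M≤ (5 ℕ.+ a)) (sym size) (sym cost) (merge-bound a (ℕ.suc j))
  where
  size : ∣ + 2 * + (5 ℕ.+ a) + + 2 * + j + -[1+ 0 ] ∣ ≡ 7 ℕ.+ 2 ℕ.* a ℕ.+ 2 ℕ.* ℕ.suc j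
  size rewrite sym (pos-* 2 j) = ∣+m+-[1+n]∣ 0 _ (double a j)
    where
    double : ∀ a j → 2 ℕ.* (5 ℕ.+ a) ℕ.+ 2 ℕ.* j ≡ 1 ℕ.+ (7 ℕ.+ 2 ℕ.* a ℕ.+ 2 ℕ.* ℕ.suc j)
    double = solve-∀
  cost : ∣ + 3 * + (5 ℕ.+ a) + + j + -[1+ 2 ] ∣ ≡ 11 ℕ.+ 3 ℕ.* a ℕ.+ ℕ.suc j
  cost = ∣+m+-[1+n]∣ 2 _ (triple a j)
    where
    triple : ∀ a j → 3 ℕ.* (5 ℕ.+ a) ℕ.+ j ≡ 3 ℕ.+ (11 ℕ.+ 3 ℕ.* a ℕ.+ ℕ.suc j)
    triple = solve-∀
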